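{- For every matroid $M$ and every natural number $i$, $$c_{M}(i) = \sum_{F\in L} c_{M^F}(\operatorname{crk} F - i) - \sum_{F\in L,\ F\neq\hat 0} c_{M^F}(i-\operatorname{rk} F).$$
   Context: Let $M$ be a matroid on a finite ground set $\mathcal{I}$ with lattice of flats $L$, and write $\hat 0$ for the minimal flat (the closure of the empty set). For a flat $F$, the localization $M_F$ is the matroid on ground set $F$ whose lattice of flats is $\{G\in L : G\le F\}$, and the contraction $M^F$ is the matroid on $\mathcal{I}\smallsetminus F$ whose lattice of flats is isomorphic to $\{G\in L: G\ge F\}$. Set $\operatorname{rk} F := \operatorname{rk} M_F$ and $\operatorname{crk} F := \operatorname{rk} M - \operatorname{rk} F$. Let $\mu$ be the Möbius function of $L$ and $\chi_M(t)=\sum_{F}\mu(\hat 0,F)t^{\operatorname{crk} F}$ the characteristic polynomial. The Kazhdan–Lusztig polynomial $P_M(t)\in\mathbb{Z}[t]$ is the unique assignment of a polynomial to every matroid such that: $P_M(t)=1$ if $\operatorname{rk} M=0$; $\deg P_M(t)<\tfrac12\operatorname{rk} M$ if $\operatorname{rk} M>0$; and $t^{\operatorname{rk} M}P_M(t^{ -1})=\sum_{F\in L}\chi_{M_F}(t)P_{M^F}(t)$ for every $M$. For an integer $j$, $c_M(j)$ denotes the coefficient of $t^j$ in $P_M(t)$ (so $c_M(j)=0$ for $j<0$). -}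

module Defs where

open import Data.Bool using (Bool; true; false; _∧_; if_then_else_)
import Data.Bool.Properties as BoolP
open import Data.Nat as ℕ using (ℕ; zero; suc; _≤_; _<_; _∸_; _≡ᵇ_)
open import Data.Integer as ℤ using (ℤ; +_; -[1+_])
open import Data.Fin using (Fin)
open import Data.Fin.Subset using (Subset; ⊥; ⁅_⁆; _⊆_; _∪_; _∩_; _─_; ∣_∣)
open import Data.Fin.Subset.Properties using (_⊆?_)
open import Data.Vec using (Vec; []; _∷_; tabulate; lookup)
open import Data.Vec.Properties using (≡-dec)
open import Data.List using (List; []; _∷_; map; _++_; filter; upTo; foldr)
open import Data.Product using (_×_)
open import Relation.Binary.PropositionalEquality using (_≡_)
open import Relation.Nullary using (Dec; yes; no; ¬_)
open import Relation.Nullary.Decidable using (_×-dec_; ¬?)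

Σℤ : List ℤ → ℤ
Σℤ = foldr ℤ._+_ (+ 0)

allSubsets : (N : ℕ) → List (Subset N)
allSubsets zero    = [] ∷ []
allSubsets (suc N) = map (false ∷_) (allSubsets N) ++ map (true ∷_) (allSubsets N)

_≟ₛ_ : {N : ℕ} → (S T : Subset N) → Dec (S ≡ T)
_≟ₛ_ = ≡-dec BoolP._≟_

-- Matroids on a ground set E ⊆ Fin N, given by their rank function.
-- (Any finite ground set is in bijection with a subset of some Fin N.)
-- Only the values of rk on subsets of E are meaningful.

record RankData (N : ℕ) : Set where
  constructor mkRD
  field
    E  : Subset N
    rk : Subset N → ℕ
open RankData public

IsMatroid : {N : ℕ} → RankData N → Set
IsMatroid D =
    (∀ A → A ⊆ E D → rk D A ≤ ∣ A ∣)
  × (∀ A B → A ⊆ B → B ⊆ E D → rk D A ≤ rk D B)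
  × (∀ A B → A ⊆ E D → B ⊆ E D →
       rk D (A ∪ B) ℕ.+ rk D (A ∩ B) ≤ rk D A ℕ.+ rk D B)

rank : {N : ℕ} → RankData N → ℕ
rank D = rk D (E D)

closure : {N : ℕ} → RankData N → Subset N → Subset N
closure D S = tabulate (λ x → lookup (E D) x ∧ (rk D (S ∪ ⁅ x ⁆) ≡ᵇ rk D S))

IsFlat : {N : ℕ} → RankData N → Subset N → Set
IsFlat D F = (F ⊆ E D) × (closure D F ≡ F)

isFlat? : {N : ℕ} (D : RankData N) (F : Subset N) → Dec (IsFlat D F)
isFlat? D F = (F ⊆? E D) ×-dec (closure D F ≟ₛ F)

-- the lattice of flats L, as a list (each flat exactly once)
flats : {N : ℕ} → RankData N → List (Subset N)
flats {N} D = filter (isFlat? D) (allSubsets N)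

zeroHat : {N : ℕ} → RankData N → Subset N
zeroHat D = closure D ⊥

-- localization M_F (ground set F) and contraction M^F (ground set E ∖ F)
loc : {N : ℕ} → RankData N → Subset N → RankData N
loc D F = mkRD F (rk D)

con : {N : ℕ} → RankData N → Subset N → RankData N
con D F = mkRD (E D ─ F) (λ S → rk D (S ∪ F) ∸ rk D F)

rkF : {N : ℕ} → RankData N → Subset N → ℕ
rkF D F = rank (loc D F)

crk : {N : ℕ} → RankData N → Subset N → ℕ
crk D F = rank D ∸ rkF D F

-- Möbius function of L:  μ(F,F) = 1,  μ(F,G) = - Σ_{F ≤ H < G} μ(F,H).
-- Defined with a fuel argument; fuel N suffices since a strict chain of
-- subsets of Fin N has at most N steps.
mobiusFuel : {N : ℕ} → RankData N → ℕ → Subset N → Subset N → ℤ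
mobiusFuel D k F G with F ≟ₛ G
... | yes _ = + 1
mobiusFuel D zero    F G | no _ = + 0
mobiusFuel D (suc k) F G | no _ =
  ℤ.- Σℤ (map (λ H → mobiusFuel D k F H)
               (filter (λ H → (F ⊆? H) ×-dec ((H ⊆? G) ×-dec ¬? (H ≟ₛ G)))
                       (flats D)))

mobius : {N : ℕ} → RankData N → Subset N → Subset N → ℤ
mobius {N} D = mobiusFuel D N

Poly : Set
Poly = ℕ → ℤ

coef : Poly → ℤ → ℤ
coef p (+ n)     = p n
coef p -[1+ n ]  = + 0

_*ₚ_ : Poly → Poly → Poly
(p *ₚ q) n = Σℤ (map (λ i → p i ℤ.* q (n ∸ i)) (upTo (suc n)))

χ : {N : ℕ} → RankData N → Poly
χ D i = Σℤ (map (λ F → if crk D F ≡ᵇ i then mobius D (zeroHat D) F else + 0)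
                (flats D))

-- Kazhdan–Lusztig axioms for an assignment P of a polynomial to every
-- matroid (on ground sets inside Fin N).  The coefficient of t^n in
-- t^{rk M} P_M(t^{-1}) is c_M(rk M - n).

IsKL : {N : ℕ} → (RankData N → Poly) → Set
IsKL {N} P = ∀ (D : RankData N) → IsMatroid D →
    (rank D ≡ 0 → (P D 0 ≡ + 1) × (∀ j → P D (suc j) ≡ + 0))
  × (0 < rank D → ∀ j → rank D ≤ 2 ℕ.* j → P D j ≡ + 0)
  × (∀ n → coef (P D) (+ rank D ℤ.- + n)
           ≡ Σℤ (map (λ F → (χ (loc D F) *ₚ P (con D F)) n) (flats D)))

nonzeroFlats : {N : ℕ} → RankData N → List (Subset N)
nonzeroFlats D = filter (λ F → ¬? (F ≟ₛ zeroHat D)) (flats D)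

module Submission where

-- For a flat F, the flats of the contraction M^F are the flats T ≥ F of M, and the localization of M^F
-- at T ∖ F has the interval [F, T] as its lattice of flats, so the recursion for M^F reads
--   c_{M^F}(crk F − n) = ∑_{T ≥ F} (χ_{[F,T]} · P_{M^T})_n.
-- Summing over F and exchanging the sums, ∑_{F ≤ T} χ_{[F,T]}(t) = t^{rk T} because the Möbius function
-- is also a right inverse of ζ; hence ∑_F c_{M^F}(crk F − i) = ∑_T c_{M^T}(i − rk T). The term T = 0̂ is
-- c_M(i), since the recursions for M and M^0̂ coincide. As P is only known through its axioms,
-- identifying (M^F)^{T ∖ F} with M^T uses that the axioms determine P_M from the rank function on the
-- ground set.

open import Defs
open import Data.Bool using (Bool; true; false; _∧_; not; T; if_then_else_)
open import Data.Empty using (⊥-elim)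
open import Data.Fin using (Fin; zero; suc) renaming (_≟_ to _≟ᶠ_)
open import Data.Fin.Subset
  using (Subset; ⊥; ⁅_⁆; _⊆_; _∪_; _∩_; _─_; ∣_∣) renaming (_∈_ to _∈ₛ_; _-_ to _-ₛ_)
open import Data.Fin.Subset.Properties
  using (_∈?_; _⊆?_; ⊆-refl; ⊆-trans; ⊆-antisym; ⊆-min; ∉⊥; x∈⁅x⁆; x∈⁅y⁆⇒x≡y
        ; p⊆p∪q; q⊆p∪q; x∈p∪q⁻; p∩q⊆p; p∩q⊆q; x∈p∩q⁺; x∈p∩q⁻; p─q⊆p; x∈p∧x∉q⇒x∈p─q; p─q─r≡p─q∪r
        ; ∪-assoc; ∪-comm; ∪-idem; ∪-identityˡ; ∪-identityʳ; ∪-distribʳ-∩; ∩-zeroˡ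
        ; p⊆q⇒∣p∣≤∣q∣; drop-∷-⊆; ∣p∣≤n; ∣⊥∣≡0; nonempty?; Empty-unique; x∈p⇒∣p-x∣<∣p∣)
open import Data.Integer using (ℤ; +_; _+_; _*_; -_; _-_)
import Data.Integer.Properties as ℤP
open import Algebra.Bundles using (AbelianGroup)
import Algebra.Properties.Group (AbelianGroup.group ℤP.+-0-abelianGroup) as ℤ+
open import Algebra.Properties.Loop ℤ+.loop using (identityˡ-unique)
open import Algebra.Properties.CommutativeSemigroup ℤP.+-commutativeSemigroup
  using () renaming (interchange to +-interchange)
open import Data.List using (List; []; _∷_; map; _++_; filter; upTo; applyUpTo; _∷ʳ_)
open import Data.List.Membership.Propositional using (_∈_)
import Data.List.Membership.Propositional.Properties as ListMemP
open import Data.List.Relation.Unary.Any using (here; there)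
import Data.List.Properties as ListP
open import Data.Nat as ℕ using (ℕ; zero; suc; _∸_; _≡ᵇ_; _≤_; _<_; z≤n; s≤s)
import Data.Nat.Properties as ℕP
open import Data.Product using (_×_; _,_; proj₁; proj₂)
open import Function using (_∘′_)
open import Data.Sum using (inj₁; inj₂; [_,_])
open import Data.Vec using ([]; _∷_; lookup; here; there)
import Data.Vec.Properties as VecP
open import Relation.Binary.Definitions using (Tri; tri<; tri≈; tri>)
open import Relation.Binary.PropositionalEquality
  using (_≡_; refl; sym; trans; cong; cong₂; subst; module ≡-Reasoning)
open import Relation.Nullary using (Dec; yes; no; ¬_; does; contradiction)
open import Relation.Nullary.Decidable using (_×-dec_; ¬?)

private
  variable
    N : ℕ
    X : Set

∑ : List X → (X → ℤ) → ℤ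
∑ xs f = Σℤ (map f xs)

infix 5 ∑
syntax ∑ xs (λ x → e) = ∑[ x ← xs ] e

∑-++ : (xs ys : List X) (f : X → ℤ) → ∑ (xs ++ ys) f ≡ ∑ xs f + ∑ ys f
∑-++ []       ys f = sym (ℤP.+-identityˡ _)
∑-++ (x ∷ xs) ys f = trans (cong (_+_ (f x)) (∑-++ xs ys f)) (sym (ℤP.+-assoc (f x) _ _))

∑-map : {Y : Set} (xs : List X) (g : X → Y) (f : Y → ℤ) → ∑ (map g xs) f ≡ ∑ xs (λ x → f (g x))
∑-map []       g f = refl
∑-map (x ∷ xs) g f = cong (_+_ (f (g x))) (∑-map xs g f)

∑-cong-∈ : (xs : List X) {f g : X → ℤ} → (∀ x → x ∈ xs → f x ≡ g x) → ∑ xs f ≡ ∑ xs g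
∑-cong-∈ []       e = refl
∑-cong-∈ (x ∷ xs) e = cong₂ _+_ (e x (here refl)) (∑-cong-∈ xs (λ y m → e y (there m)))

∑-cong : (xs : List X) {f g : X → ℤ} → (∀ x → f x ≡ g x) → ∑ xs f ≡ ∑ xs g
∑-cong xs e = ∑-cong-∈ xs (λ x _ → e x)

∑-zero : (xs : List X) → ∑[ x ← xs ] + 0 ≡ + 0
∑-zero []       = refl
∑-zero (x ∷ xs) = trans (ℤP.+-identityˡ _) (∑-zero xs)

∑-+ : (xs : List X) (f g : X → ℤ) → ∑[ x ← xs ] (f x + g x) ≡ ∑ xs f + ∑ xs g
∑-+ []       f g = refl
∑-+ (x ∷ xs) f g = trans (cong (_+_ (f x + g x)) (∑-+ xs f g)) (+-interchange (f x) (g x) _ _)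

∑-*ʳ : (xs : List X) (f : X → ℤ) (c : ℤ) → ∑[ x ← xs ] (f x * c) ≡ ∑ xs f * c
∑-*ʳ []       f c = sym (ℤP.*-zeroˡ c)
∑-*ʳ (x ∷ xs) f c = trans (cong (_+_ (f x * c)) (∑-*ʳ xs f c)) (sym (ℤP.*-distribʳ-+ c (f x) _))

∑-*ˡ : (xs : List X) (c : ℤ) (f : X → ℤ) → ∑[ x ← xs ] (c * f x) ≡ c * ∑ xs f
∑-*ˡ []       c f = sym (ℤP.*-zeroʳ c)
∑-*ˡ (x ∷ xs) c f = trans (cong (_+_ (c * f x)) (∑-*ˡ xs c f)) (sym (ℤP.*-distribˡ-+ c (f x) _))

∑-swap : {Y : Set} (xs : List X) (ys : List Y) (f : X → Y → ℤ) →
         ∑[ x ← xs ] ∑[ y ← ys ] f x y ≡ ∑[ y ← ys ] ∑[ x ← xs ] f x y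
∑-swap []       ys f = sym (∑-zero ys)
∑-swap (x ∷ xs) ys f =
  trans (cong (_+_ (∑ ys (f x))) (∑-swap xs ys f)) (sym (∑-+ ys (f x) (λ y → ∑[ x′ ← xs ] f x′ y)))

-- The Iverson bracket, written with if_then_else_ so that it matches the summands of χ.
when : Bool → ℤ → ℤ
when b x = if b then x else + 0

when? : {P : Set} → Dec P → ℤ → ℤ
when? d = when (does d)

∑-filter : {P : X → Set} (P? : ∀ x → Dec (P x)) (xs : List X) (f : X → ℤ) →
           ∑ (filter P? xs) f ≡ ∑[ x ← xs ] when? (P? x) (f x)
∑-filter P? []       f = refl
∑-filter P? (x ∷ xs) f with does (P? x)
... | true  = cong (_+_ (f x)) (∑-filter P? xs f)
... | false = trans (∑-filter P? xs f) (sym (ℤP.+-identityˡ _))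

∑-when : (b : Bool) (xs : List X) (f : X → ℤ) → ∑[ x ← xs ] when b (f x) ≡ when b (∑ xs f)
∑-when true  xs f = refl
∑-when false xs f = ∑-zero xs

when-zero : (b : Bool) → when b (+ 0) ≡ + 0
when-zero true  = refl
when-zero false = refl

when-+ : (b : Bool) (x y : ℤ) → when b (x + y) ≡ when b x + when b y
when-+ true  x y = refl
when-+ false x y = refl

when-*ʳ : (b : Bool) (x y : ℤ) → when b x * y ≡ when b (x * y)
when-*ʳ true  x y = refl
when-*ʳ false x y = refl

when-*ˡ : (b : Bool) (x y : ℤ) → x * when b y ≡ when b (x * y)
when-*ˡ true  x y = refl
when-*ˡ false x y = ℤP.*-zeroʳ x

when-∧ : (a b : Bool) (x : ℤ) → when (a ∧ b) x ≡ when a (when b x)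
when-∧ true  b x = refl
when-∧ false b x = refl

when-comm : (a b : Bool) (x : ℤ) → when a (when b x) ≡ when b (when a x)
when-comm true  true  x = refl
when-comm true  false x = refl
when-comm false true  x = refl
when-comm false false x = refl

when?-cong : {P : Set} (d : Dec P) {x y : ℤ} → (P → x ≡ y) → when? d x ≡ when? d y
when?-cong (yes p) f = f p
when?-cong (no _)  f = refl

when?-yes : {P : Set} (d : Dec P) (x : ℤ) → P → when? d x ≡ x
when?-yes (yes _) x p = refl
when?-yes (no ¬p) x p = contradiction p ¬p

when?-no : {P : Set} (d : Dec P) (x : ℤ) → ¬ P → when? d x ≡ + 0
when?-no (yes p) x ¬p = contradiction p ¬p
when?-no (no _)  x ¬p = refl

when?-split : {P : Set} (d : Dec P) (x : ℤ) → x ≡ when? d x + when? (¬? d) x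
when?-split (yes _) x = sym (ℤP.+-identityʳ x)
when?-split (no _)  x = sym (ℤP.+-identityˡ x)

does-⇔ : {P Q : Set} (p : Dec P) (q : Dec Q) → (P → Q) → (Q → P) → does p ≡ does q
does-⇔ (yes _) (yes _) f g = refl
does-⇔ (yes p) (no ¬q) f g = contradiction (f p) ¬q
does-⇔ (no ¬p) (yes q) f g = contradiction (g q) ¬p
does-⇔ (no _)  (no _)  f g = refl

∈⇒lookup : {x : Fin N} {p : Subset N} → x ∈ₛ p → lookup p x ≡ true
∈⇒lookup = VecP.[]=⇒lookup

lookup⇒∈ : {x : Fin N} {p : Subset N} → lookup p x ≡ true → x ∈ₛ p
lookup⇒∈ {x = x} {p} = VecP.lookup⇒[]= x p

x∈p─q⇒x∉q : {x : Fin N} {p q : Subset N} → x ∈ₛ p ─ q → ¬ x ∈ₛ q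
x∈p─q⇒x∉q {p = _ ∷ _} {false ∷ _} here      ()
x∈p─q⇒x∉q {p = _ ∷ _} {_     ∷ _} (there m) (there x∈q) = x∈p─q⇒x∉q m x∈q

∪-least : {p q r : Subset N} → p ⊆ r → q ⊆ r → p ∪ q ⊆ r
∪-least {p = p} {q} p⊆r q⊆r m = [ p⊆r , q⊆r ] (x∈p∪q⁻ p q m)

x∈p⇒⁅x⁆⊆p : {x : Fin N} {p : Subset N} → x ∈ₛ p → ⁅ x ⁆ ⊆ p
x∈p⇒⁅x⁆⊆p {x = x} {p} x∈p y∈⁅x⁆ = subst (_∈ₛ p) (sym (x∈⁅y⁆⇒x≡y x y∈⁅x⁆)) x∈p

p⊆q⇒p∪q≡q : {p q : Subset N} → p ⊆ q → p ∪ q ≡ q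
p⊆q⇒p∪q≡q {p = p} {q} p⊆q = ⊆-antisym (∪-least p⊆q ⊆-refl) (q⊆p∪q p q)

x∈p⇒p≡⁅x⁆∪p-x : {x : Fin N} {p : Subset N} → x ∈ₛ p → p ≡ ⁅ x ⁆ ∪ (p -ₛ x)
x∈p⇒p≡⁅x⁆∪p-x {x = x} {p} x∈p = ⊆-antisym split (∪-least (x∈p⇒⁅x⁆⊆p x∈p) (p─q⊆p p ⁅ x ⁆))
  where
  split : p ⊆ ⁅ x ⁆ ∪ (p -ₛ x)
  split {y} y∈p with y ≟ᶠ x
  ... | yes refl = p⊆p∪q (p -ₛ x) (x∈⁅x⁆ x)
  ... | no  y≢x  = q⊆p∪q ⁅ x ⁆ (p -ₛ x) (x∈p∧x∉q⇒x∈p─q y∈p (y≢x ∘′ x∈⁅y⁆⇒x≡y x))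

─-monoˡ : {p p′ : Subset N} (q : Subset N) → p ⊆ p′ → p ─ q ⊆ p′ ─ q
─-monoˡ {p = p} q p⊆p′ m = x∈p∧x∉q⇒x∈p─q (p⊆p′ (p─q⊆p p q m)) (x∈p─q⇒x∉q m)

p⊆[p─q]∪q : (p q : Subset N) → p ⊆ (p ─ q) ∪ q
p⊆[p─q]∪q p q {x} x∈p with x ∈? q
... | yes x∈q = q⊆p∪q (p ─ q) q x∈q
... | no  x∉q = p⊆p∪q q (x∈p∧x∉q⇒x∈p─q x∈p x∉q)

q⊆p⇒[p─q]∪q≡p : {p q : Subset N} → q ⊆ p → (p ─ q) ∪ q ≡ p
q⊆p⇒[p─q]∪q≡p {p = p} {q} q⊆p = ⊆-antisym (∪-least (p─q⊆p p q) q⊆p) (p⊆[p─q]∪q p q)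

p∩q≡⊥⇒x∉q : {x : Fin N} {p q : Subset N} → p ∩ q ≡ ⊥ → x ∈ₛ p → ¬ x ∈ₛ q
p∩q≡⊥⇒x∉q {p = p} {q} p∩q≡⊥ x∈p x∈q = ∉⊥ (subst (_ ∈ₛ_) p∩q≡⊥ (x∈p∩q⁺ (x∈p , x∈q)))

x∉q⇒p∩q≡⊥ : {p q : Subset N} → (∀ {x} → x ∈ₛ p → ¬ x ∈ₛ q) → p ∩ q ≡ ⊥
x∉q⇒p∩q≡⊥ {p = p} {q} x∉q = ⊆-antisym empty (⊆-min _)
  where
  empty : p ∩ q ⊆ ⊥
  empty m = contradiction (proj₂ (x∈p∩q⁻ p q m)) (x∉q (proj₁ (x∈p∩q⁻ p q m)))

[p─q]∩q≡⊥ : (p q : Subset N) → (p ─ q) ∩ q ≡ ⊥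
[p─q]∩q≡⊥ p q = x∉q⇒p∩q≡⊥ x∈p─q⇒x∉q

p∩q≡⊥⇒[p∪q]─q≡p : {p q : Subset N} → p ∩ q ≡ ⊥ → (p ∪ q) ─ q ≡ p
p∩q≡⊥⇒[p∪q]─q≡p {p = p} {q} p∩q≡⊥ = ⊆-antisym shrink grow
  where
  shrink : (p ∪ q) ─ q ⊆ p
  shrink m = [ (λ x∈p → x∈p) , (λ x∈q → contradiction x∈q (x∈p─q⇒x∉q m)) ] (x∈p∪q⁻ p q (p─q⊆p _ q m))
  grow : p ⊆ (p ∪ q) ─ q
  grow x∈p = x∈p∧x∉q⇒x∈p─q (p⊆p∪q q x∈p) (p∩q≡⊥⇒x∉q p∩q≡⊥ x∈p)

p─q⊆r⇒p⊆r∪q : {p q r : Subset N} → p ─ q ⊆ r → p ⊆ r ∪ q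
p─q⊆r⇒p⊆r∪q {p = p} {q} {r} p─q⊆r = ⊆-trans (p⊆[p─q]∪q p q) (∪-least (⊆-trans p─q⊆r (p⊆p∪q q)) (q⊆p∪q r q))

p⊆r∪q⇒p─q⊆r : {p q r : Subset N} → p ⊆ r ∪ q → p ─ q ⊆ r
p⊆r∪q⇒p─q⊆r {p = p} {q} {r} p⊆r∪q m =
  [ (λ x∈r → x∈r) , (λ x∈q → contradiction x∈q (x∈p─q⇒x∉q m)) ] (x∈p∪q⁻ r q (p⊆r∪q (p─q⊆p p q m)))

p⊆r─q⇒p∪q⊆r : {p q r : Subset N} → q ⊆ r → p ⊆ r ─ q → p ∪ q ⊆ r
p⊆r─q⇒p∪q⊆r {q = q} {r} q⊆r p⊆r─q = ∪-least (⊆-trans p⊆r─q (p─q⊆p r q)) q⊆r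

p∪q⊆r⇒p⊆r─q : {p q r : Subset N} → p ∩ q ≡ ⊥ → p ∪ q ⊆ r → p ⊆ r ─ q
p∪q⊆r⇒p⊆r─q {q = q} p∩q≡⊥ p∪q⊆r x∈p =
  x∈p∧x∉q⇒x∈p─q (p∪q⊆r (p⊆p∪q q x∈p)) (p∩q≡⊥⇒x∉q p∩q≡⊥ x∈p)

⊆∧≢⇒∣p∣<∣q∣ : {p q : Subset N} → p ⊆ q → ¬ p ≡ q → ∣ p ∣ < ∣ q ∣
⊆∧≢⇒∣p∣<∣q∣ {p = []}        {[]}        _   p≢q = contradiction refl p≢q
⊆∧≢⇒∣p∣<∣q∣ {p = false ∷ p} {false ∷ q} p⊆q p≢q = ⊆∧≢⇒∣p∣<∣q∣ (drop-∷-⊆ p⊆q) (p≢q ∘′ cong (false ∷_))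
⊆∧≢⇒∣p∣<∣q∣ {p = false ∷ p} {true  ∷ q} p⊆q _   = s≤s (p⊆q⇒∣p∣≤∣q∣ (drop-∷-⊆ p⊆q))
⊆∧≢⇒∣p∣<∣q∣ {p = true  ∷ p} {false ∷ q} p⊆q _   with p⊆q here
... | ()
⊆∧≢⇒∣p∣<∣q∣ {p = true  ∷ p} {true  ∷ q} p⊆q p≢q =
  s≤s (⊆∧≢⇒∣p∣<∣q∣ (drop-∷-⊆ p⊆q) (p≢q ∘′ cong (true ∷_)))

[p∪q]∪r≡[p∪r]∪q : (p q r : Subset N) → (p ∪ q) ∪ r ≡ (p ∪ r) ∪ q
[p∪q]∪r≡[p∪r]∪q p q r = trans (∪-assoc p q r) (trans (cong (p ∪_) (∪-comm q r)) (sym (∪-assoc p r q)))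

≡ᵇ-true⇒≡ : {m n : ℕ} → (m ≡ᵇ n) ≡ true → m ≡ n
≡ᵇ-true⇒≡ {m} {n} e = ℕP.≡ᵇ⇒≡ m n (subst T (sym e) _)

≡⇒≡ᵇ-true : {m n : ℕ} → m ≡ n → (m ≡ᵇ n) ≡ true
≡⇒≡ᵇ-true {m} {n} e with m ≡ᵇ n | ℕP.≡⇒≡ᵇ m n e
... | true | _ = refl

lookup-closure : (D : RankData N) (S : Subset N) (x : Fin N) →
  lookup (closure D S) x ≡ lookup (E D) x ∧ (rk D (S ∪ ⁅ x ⁆) ≡ᵇ rk D S)
lookup-closure D S x = VecP.lookup∘tabulate _ x

∈-closure⁺ : (D : RankData N) {S : Subset N} {x : Fin N} →
  x ∈ₛ E D → rk D (S ∪ ⁅ x ⁆) ≡ rk D S → x ∈ₛ closure D S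
∈-closure⁺ D {S} {x} x∈E eq =
  lookup⇒∈ (trans (lookup-closure D S x) (cong₂ _∧_ (∈⇒lookup x∈E) (≡⇒≡ᵇ-true eq)))

∈-closure⁻ : (D : RankData N) {S : Subset N} {x : Fin N} →
  x ∈ₛ closure D S → x ∈ₛ E D × rk D (S ∪ ⁅ x ⁆) ≡ rk D S
∈-closure⁻ D {S} {x} m
  with lookup (E D) x in x∈E | rk D (S ∪ ⁅ x ⁆) ≡ᵇ rk D S in eq
     | trans (sym (lookup-closure D S x)) (∈⇒lookup m)
... | true | true | _ = lookup⇒∈ x∈E , ≡ᵇ-true⇒≡ eq

closure-loc⊆closure : (D : RankData N) {G S : Subset N} → G ⊆ E D → closure (loc D G) S ⊆ closure D S
closure-loc⊆closure D {G} G⊆E m with ∈-closure⁻ (loc D G) m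
... | x∈G , eq = ∈-closure⁺ D (G⊆E x∈G) eq

module Closure (M : RankData N) (isM : IsMatroid M) where

  rk-≤-∣∣ : ∀ S → S ⊆ E M → rk M S ≤ ∣ S ∣
  rk-≤-∣∣ = proj₁ isM

  rk-mono : ∀ S S′ → S ⊆ S′ → S′ ⊆ E M → rk M S ≤ rk M S′
  rk-mono = proj₁ (proj₂ isM)

  rk-submodular : ∀ S S′ → S ⊆ E M → S′ ⊆ E M →
                  rk M (S ∪ S′) ℕ.+ rk M (S ∩ S′) ≤ rk M S ℕ.+ rk M S′
  rk-submodular = proj₂ (proj₂ isM)

  rk-⊥ : rk M ⊥ ≡ 0
  rk-⊥ = ℕP.n≤0⇒n≡0 (ℕP.≤-trans (rk-≤-∣∣ ⊥ (⊆-min (E M))) (ℕP.≤-reflexive (∣⊥∣≡0 N)))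

  closure⊆E : ∀ S → closure M S ⊆ E M
  closure⊆E S m = proj₁ (∈-closure⁻ M m)

  rk-insert-closure : ∀ {S x} → x ∈ₛ closure M S → rk M (S ∪ ⁅ x ⁆) ≡ rk M S
  rk-insert-closure m = proj₂ (∈-closure⁻ M m)

  ⊆-closure : ∀ {S} → S ⊆ E M → S ⊆ closure M S
  ⊆-closure {S} S⊆E {x} x∈S = ∈-closure⁺ M (S⊆E x∈S) (cong (rk M) absorb)
    where
    absorb : S ∪ ⁅ x ⁆ ≡ S
    absorb = trans (∪-comm S ⁅ x ⁆) (p⊆q⇒p∪q≡q (x∈p⇒⁅x⁆⊆p x∈S))

  -- Submodularity applied to S ∪ {x} and S′.
  rk-insert-mono : ∀ {S S′ x} → S ⊆ S′ → S′ ⊆ E M → x ∈ₛ E M →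
                   rk M (S ∪ ⁅ x ⁆) ≡ rk M S → rk M (S′ ∪ ⁅ x ⁆) ≡ rk M S′
  rk-insert-mono {S} {S′} {x} S⊆S′ S′⊆E x∈E eq =
    ℕP.≤-antisym (ℕP.+-cancelʳ-≤ (rk M S) _ _ bound) (rk-mono _ _ (p⊆p∪q _) S′xE)
    where
    S′xE : S′ ∪ ⁅ x ⁆ ⊆ E M
    S′xE = ∪-least S′⊆E (x∈p⇒⁅x⁆⊆p x∈E)
    SxE : S ∪ ⁅ x ⁆ ⊆ E M
    SxE = ⊆-trans (∪-least (⊆-trans S⊆S′ (p⊆p∪q _)) (q⊆p∪q _ _)) S′xE
    union : (S ∪ ⁅ x ⁆) ∪ S′ ≡ S′ ∪ ⁅ x ⁆
    union = begin
      (S ∪ ⁅ x ⁆) ∪ S′ ≡⟨ cong (_∪ S′) (∪-comm S ⁅ x ⁆) ⟩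
      (⁅ x ⁆ ∪ S) ∪ S′ ≡⟨ ∪-assoc ⁅ x ⁆ S S′ ⟩
      ⁅ x ⁆ ∪ (S ∪ S′) ≡⟨ cong (⁅ x ⁆ ∪_) (p⊆q⇒p∪q≡q S⊆S′) ⟩
      ⁅ x ⁆ ∪ S′       ≡⟨ ∪-comm ⁅ x ⁆ S′ ⟩
      S′ ∪ ⁅ x ⁆       ∎
      where open ≡-Reasoning
    meet : S ⊆ (S ∪ ⁅ x ⁆) ∩ S′
    meet m = x∈p∩q⁺ (p⊆p∪q _ m , S⊆S′ m)
    bound : rk M (S′ ∪ ⁅ x ⁆) ℕ.+ rk M S ≤ rk M S′ ℕ.+ rk M S
    bound = begin
      rk M (S′ ∪ ⁅ x ⁆) ℕ.+ rk M S
        ≤⟨ ℕP.+-monoʳ-≤ _ (rk-mono _ _ meet (⊆-trans (p∩q⊆q _ _) S′⊆E)) ⟩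
      rk M (S′ ∪ ⁅ x ⁆) ℕ.+ rk M ((S ∪ ⁅ x ⁆) ∩ S′)
        ≡⟨ cong (λ Z → rk M Z ℕ.+ rk M ((S ∪ ⁅ x ⁆) ∩ S′)) union ⟨
      rk M ((S ∪ ⁅ x ⁆) ∪ S′) ℕ.+ rk M ((S ∪ ⁅ x ⁆) ∩ S′)
        ≤⟨ rk-submodular _ _ SxE S′⊆E ⟩
      rk M (S ∪ ⁅ x ⁆) ℕ.+ rk M S′
        ≡⟨ cong (ℕ._+ rk M S′) eq ⟩
      rk M S ℕ.+ rk M S′
        ≡⟨ ℕP.+-comm (rk M S) _ ⟩
      rk M S′ ℕ.+ rk M S ∎
      where open ℕP.≤-Reasoning

  closure-mono : ∀ {S S′} → S ⊆ S′ → S′ ⊆ E M → closure M S ⊆ closure M S′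
  closure-mono S⊆S′ S′⊆E m with ∈-closure⁻ M m
  ... | x∈E , eq = ∈-closure⁺ M x∈E (rk-insert-mono S⊆S′ S′⊆E x∈E eq)

  rk-∪-closure-≤ : ∀ k {A B} → ∣ A ∣ ≤ k → B ⊆ E M → A ⊆ closure M B → rk M (B ∪ A) ≡ rk M B
  rk-∪-closure-≤ k {A} {B} _ _ _ with nonempty? A
  rk-∪-closure-≤ k {A} {B} _ _ _ | no empty =
    trans (cong (λ Z → rk M (B ∪ Z)) (Empty-unique empty)) (cong (rk M) (∪-identityʳ B))
  rk-∪-closure-≤ zero          ∣A∣≤0 _ _ | yes (x , x∈A) =
    contradiction (ℕP.<-≤-trans (x∈p⇒∣p-x∣<∣p∣ x∈A) ∣A∣≤0) ℕP.n≮0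
  rk-∪-closure-≤ (suc k) {A} {B} ∣A∣≤k B⊆E A⊆clB | yes (x , x∈A) = begin
    rk M (B ∪ A)                    ≡⟨ cong (λ Z → rk M (B ∪ Z)) (x∈p⇒p≡⁅x⁆∪p-x x∈A) ⟩
    rk M (B ∪ (⁅ x ⁆ ∪ (A -ₛ x)))   ≡⟨ cong (rk M) (∪-assoc B ⁅ x ⁆ (A -ₛ x)) ⟨
    rk M ((B ∪ ⁅ x ⁆) ∪ (A -ₛ x))   ≡⟨ rk-∪-closure-≤ k ∣A-x∣≤k Bx⊆E A-x⊆clBx ⟩
    rk M (B ∪ ⁅ x ⁆)                ≡⟨ rk-insert-closure (A⊆clB x∈A) ⟩
    rk M B                          ∎
    where
    open ≡-Reasoning
    ∣A-x∣≤k : ∣ A -ₛ x ∣ ≤ k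
    ∣A-x∣≤k = ℕP.≤-pred (ℕP.<-≤-trans (x∈p⇒∣p-x∣<∣p∣ x∈A) ∣A∣≤k)
    Bx⊆E : B ∪ ⁅ x ⁆ ⊆ E M
    Bx⊆E = ∪-least B⊆E (x∈p⇒⁅x⁆⊆p (closure⊆E B (A⊆clB x∈A)))
    A-x⊆clBx : A -ₛ x ⊆ closure M (B ∪ ⁅ x ⁆)
    A-x⊆clBx m = closure-mono (p⊆p∪q _) Bx⊆E (A⊆clB (p─q⊆p A ⁅ x ⁆ m))

  rk-closure : ∀ {S} → S ⊆ E M → rk M (closure M S) ≡ rk M S
  rk-closure {S} S⊆E = begin
    rk M (closure M S)       ≡⟨ cong (rk M) (p⊆q⇒p∪q≡q (⊆-closure S⊆E)) ⟨
    rk M (S ∪ closure M S)   ≡⟨ rk-∪-closure-≤ _ ℕP.≤-refl S⊆E ⊆-refl ⟩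
    rk M S                   ∎
    where open ≡-Reasoning

  closure-idem : ∀ {S} → S ⊆ E M → closure M (closure M S) ≡ closure M S
  closure-idem {S} S⊆E = ⊆-antisym shrink (⊆-closure (closure⊆E S))
    where
    shrink : closure M (closure M S) ⊆ closure M S
    shrink {x} m with ∈-closure⁻ M m
    ... | x∈E , eq = ∈-closure⁺ M x∈E (ℕP.≤-antisym upper (rk-mono _ _ (p⊆p∪q _) Sx⊆E))
      where
      Sx⊆E : S ∪ ⁅ x ⁆ ⊆ E M
      Sx⊆E = ∪-least S⊆E (x∈p⇒⁅x⁆⊆p x∈E)
      upper : rk M (S ∪ ⁅ x ⁆) ≤ rk M S
      upper = begin
        rk M (S ∪ ⁅ x ⁆)           ≤⟨ rk-mono _ _ (∪-least (⊆-trans (⊆-closure S⊆E) (p⊆p∪q _)) (q⊆p∪q _ _))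
                                                  (∪-least (closure⊆E S) (x∈p⇒⁅x⁆⊆p x∈E)) ⟩
        rk M (closure M S ∪ ⁅ x ⁆) ≡⟨ eq ⟩
        rk M (closure M S)         ≡⟨ rk-closure S⊆E ⟩
        rk M S                     ∎
        where open ℕP.≤-Reasoning

∸-+-distrib : ∀ {a b f} → f ≤ a → f ≤ b → (a ∸ f) ℕ.+ (b ∸ f) ≡ (a ℕ.+ b) ∸ (f ℕ.+ f)
∸-+-distrib {a} {b} {f} f≤a f≤b = begin
  (a ∸ f) ℕ.+ (b ∸ f)       ≡⟨ ℕP.+-∸-assoc (a ∸ f) f≤b ⟨
  ((a ∸ f) ℕ.+ b) ∸ f       ≡⟨ cong (_∸ f) (ℕP.+-∸-comm b f≤a) ⟨
  ((a ℕ.+ b) ∸ f) ∸ f       ≡⟨ ℕP.∸-+-assoc (a ℕ.+ b) f f ⟩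
  (a ℕ.+ b) ∸ (f ℕ.+ f)     ∎
  where open ≡-Reasoning

module Contraction (M : RankData N) (isM : IsMatroid M) where
  open Closure M isM

  rank-con : ∀ {F} → F ⊆ E M → rank (con M F) ≡ rank M ∸ rk M F
  rank-con {F} F⊆E = cong (λ X → rk M X ∸ rk M F) (q⊆p⇒[p─q]∪q≡p F⊆E)

  rank-con-< : ∀ {F} → F ⊆ E M → ¬ rk M F ≡ 0 → rank (con M F) < rank M
  rank-con-< {F} F⊆E rk≢0 =
    subst (_< rank M) (sym (rank-con F⊆E)) (ℕP.∸-monoʳ-< {o = 0} (ℕP.n≢0⇒n>0 rk≢0) (rk-mono F (E M) F⊆E ⊆-refl))

  con-isMatroid : ∀ {F} → F ⊆ E M → IsMatroid (con M F)
  con-isMatroid {F} F⊆E = bounded , monotone , submodular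
    where
    ⊆E : ∀ {S} → S ⊆ E M ─ F → S ⊆ E M
    ⊆E S⊆ = ⊆-trans S⊆ (p─q⊆p _ F)
    ∪F⊆E : ∀ {S} → S ⊆ E M → S ∪ F ⊆ E M
    ∪F⊆E S⊆E = ∪-least S⊆E F⊆E
    rk-F≤ : ∀ {S} → S ⊆ E M → rk M F ≤ rk M (S ∪ F)
    rk-F≤ S⊆E = rk-mono _ _ (q⊆p∪q _ F) (∪F⊆E S⊆E)
    bounded : ∀ A → A ⊆ E M ─ F → rk M (A ∪ F) ∸ rk M F ≤ ∣ A ∣
    bounded A A⊆ = ℕP.≤-trans (ℕP.m≤n+o⇒m∸n≤o _ (rk M F) union-bound) (rk-≤-∣∣ A (⊆E A⊆))
      where
      union-bound : rk M (A ∪ F) ≤ rk M F ℕ.+ rk M A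
      union-bound = begin
        rk M (A ∪ F)                      ≤⟨ ℕP.m≤m+n _ _ ⟩
        rk M (A ∪ F) ℕ.+ rk M (A ∩ F)     ≤⟨ rk-submodular A F (⊆E A⊆) F⊆E ⟩
        rk M A ℕ.+ rk M F                 ≡⟨ ℕP.+-comm (rk M A) _ ⟩
        rk M F ℕ.+ rk M A                 ∎
        where open ℕP.≤-Reasoning
    monotone : ∀ A B → A ⊆ B → B ⊆ E M ─ F → rk M (A ∪ F) ∸ rk M F ≤ rk M (B ∪ F) ∸ rk M F
    monotone A B A⊆B B⊆ = ℕP.∸-monoˡ-≤ (rk M F)
      (rk-mono _ _ (∪-least (⊆-trans A⊆B (p⊆p∪q F)) (q⊆p∪q B F)) (∪F⊆E (⊆E B⊆)))
    submodular : ∀ A B → A ⊆ E M ─ F → B ⊆ E M ─ F →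
      (rk M ((A ∪ B) ∪ F) ∸ rk M F) ℕ.+ (rk M ((A ∩ B) ∪ F) ∸ rk M F)
        ≤ (rk M (A ∪ F) ∸ rk M F) ℕ.+ (rk M (B ∪ F) ∸ rk M F)
    submodular A B A⊆ B⊆ = begin
      (rk M ((A ∪ B) ∪ F) ∸ rk M F) ℕ.+ (rk M ((A ∩ B) ∪ F) ∸ rk M F)
        ≡⟨ ∸-+-distrib (rk-F≤ (∪-least (⊆E A⊆) (⊆E B⊆))) (rk-F≤ (⊆-trans (p∩q⊆p A B) (⊆E A⊆))) ⟩
      (rk M ((A ∪ B) ∪ F) ℕ.+ rk M ((A ∩ B) ∪ F)) ∸ (rk M F ℕ.+ rk M F)
        ≡⟨ cong₂ (λ X Y → (rk M X ℕ.+ rk M Y) ∸ (rk M F ℕ.+ rk M F)) join meet ⟨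
      (rk M ((A ∪ F) ∪ (B ∪ F)) ℕ.+ rk M ((A ∪ F) ∩ (B ∪ F))) ∸ (rk M F ℕ.+ rk M F)
        ≤⟨ ℕP.∸-monoˡ-≤ (rk M F ℕ.+ rk M F) (rk-submodular _ _ (∪F⊆E (⊆E A⊆)) (∪F⊆E (⊆E B⊆))) ⟩
      (rk M (A ∪ F) ℕ.+ rk M (B ∪ F)) ∸ (rk M F ℕ.+ rk M F)
        ≡⟨ ∸-+-distrib (rk-F≤ (⊆E A⊆)) (rk-F≤ (⊆E B⊆)) ⟨
      (rk M (A ∪ F) ∸ rk M F) ℕ.+ (rk M (B ∪ F) ∸ rk M F) ∎
      where
      open ℕP.≤-Reasoning
      join : (A ∪ F) ∪ (B ∪ F) ≡ (A ∪ B) ∪ F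
      join = trans ([p∪q]∪r≡[p∪r]∪q A F (B ∪ F))
               (trans (cong (_∪ F) (sym (∪-assoc A B F)))
                 (trans (∪-assoc (A ∪ B) F F) (cong ((A ∪ B) ∪_) (∪-idem F))))
      meet : (A ∪ F) ∩ (B ∪ F) ≡ (A ∩ B) ∪ F
      meet = sym (∪-distribʳ-∩ F A B)

∑-allSubsets-suc : (N : ℕ) (f : Subset (suc N) → ℤ) →
  ∑ (allSubsets (suc N)) f ≡ (∑[ S ← allSubsets N ] f (false ∷ S)) + (∑[ S ← allSubsets N ] f (true ∷ S))
∑-allSubsets-suc N f =
  trans (∑-++ (map (false ∷_) (allSubsets N)) _ f)
        (cong₂ _+_ (∑-map (allSubsets N) (false ∷_) f) (∑-map (allSubsets N) (true ∷_) f))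

∑-allSubsets-δ : (T : Subset N) (f : Subset N → ℤ) → ∑[ S ← allSubsets N ] when? (S ≟ₛ T) (f S) ≡ f T
∑-allSubsets-δ []          f = ℤP.+-identityʳ _
∑-allSubsets-δ {suc N} (false ∷ T) f =
  trans (∑-allSubsets-suc N _)
        (trans (cong₂ _+_ (∑-allSubsets-δ T (λ S → f (false ∷ S))) (∑-zero (allSubsets N)))
               (ℤP.+-identityʳ _))
∑-allSubsets-δ {suc N} (true ∷ T) f =
  trans (∑-allSubsets-suc N _)
        (trans (cong₂ _+_ (∑-zero (allSubsets N)) (∑-allSubsets-δ T (λ S → f (true ∷ S))))
               (ℤP.+-identityˡ _))

disjoint? : (S F : Subset N) → Dec (S ∩ F ≡ ⊥)
disjoint? S F = (S ∩ F) ≟ₛ ⊥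

-- S ↦ S ∪ F is a bijection from the subsets disjoint from F onto those containing F.
∑-allSubsets-∪ : (F : Subset N) (g : Subset N → ℤ) →
  ∑[ S ← allSubsets N ] when? (disjoint? S F) (g (S ∪ F)) ≡ ∑[ S ← allSubsets N ] when? (F ⊆? S) (g S)
∑-allSubsets-∪ []          g = refl
∑-allSubsets-∪ {suc N} (false ∷ F) g =
  trans (∑-allSubsets-suc N _)
        (trans (cong₂ _+_ (∑-allSubsets-∪ F (λ S → g (false ∷ S))) (∑-allSubsets-∪ F (λ S → g (true ∷ S))))
               (sym (∑-allSubsets-suc N _)))
∑-allSubsets-∪ {suc N} (true ∷ F) g =
  trans (∑-allSubsets-suc N _)
        (trans (cong₂ _+_ (∑-allSubsets-∪ F (λ S → g (true ∷ S))) (∑-zero (allSubsets N)))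
               (trans (ℤP.+-comm (∑[ S ← allSubsets N ] when? (F ⊆? S) (g (true ∷ S))) (+ 0))
                      (trans (cong (_+ (∑[ S ← allSubsets N ] when? (F ⊆? S) (g (true ∷ S))))
                                   (sym (∑-zero (allSubsets N))))
                             (sym (∑-allSubsets-suc N _)))))

∑-flats : (M : RankData N) (f : Subset N → ℤ) →
  ∑ (flats M) f ≡ ∑[ S ← allSubsets N ] when? (isFlat? M S) (f S)
∑-flats {N} M f = ∑-filter (isFlat? M) (allSubsets N) f

∈flats⇒IsFlat : {M : RankData N} {F : Subset N} → F ∈ flats M → IsFlat M F
∈flats⇒IsFlat {N} {M} m = proj₂ (ListMemP.∈-filter⁻ (isFlat? M) {xs = allSubsets N} m)

∑-flats-δ : (M : RankData N) {T : Subset N} (f : Subset N → ℤ) → IsFlat M T →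
  ∑[ S ← flats M ] when? (S ≟ₛ T) (f S) ≡ f T
∑-flats-δ {N} M {T} f T-flat = begin
  ∑[ S ← flats M ] when? (S ≟ₛ T) (f S)
    ≡⟨ ∑-flats M _ ⟩
  ∑[ S ← allSubsets N ] when? (isFlat? M S) (when? (S ≟ₛ T) (f S))
    ≡⟨ ∑-cong (allSubsets N) (λ S → when-comm (does (isFlat? M S)) (does (S ≟ₛ T)) (f S)) ⟩
  ∑[ S ← allSubsets N ] when? (S ≟ₛ T) (when? (isFlat? M S) (f S))
    ≡⟨ ∑-allSubsets-δ T _ ⟩
  when? (isFlat? M T) (f T)
    ≡⟨ when?-yes (isFlat? M T) _ T-flat ⟩
  f T ∎
  where open ≡-Reasoning

module Flats (M : RankData N) (isM : IsMatroid M) where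
  open Closure M isM

  closure-least : ∀ {S T} → IsFlat M T → S ⊆ T → closure M S ⊆ T
  closure-least (T⊆E , closed) S⊆T m = subst (_ ∈ₛ_) closed (closure-mono S⊆T T⊆E m)

  0̂-flat : IsFlat M (zeroHat M)
  0̂-flat = closure⊆E ⊥ , closure-idem (⊆-min _)

  rk-0̂ : rk M (zeroHat M) ≡ 0
  rk-0̂ = trans (rk-closure (⊆-min _)) rk-⊥

  0̂⊆flat : ∀ {T} → IsFlat M T → zeroHat M ⊆ T
  0̂⊆flat T-flat = closure-least T-flat (⊆-min _)

  closure-con : ∀ {F S} → F ⊆ E M → S ⊆ E M → closure (con M F) S ≡ closure M (S ∪ F) ─ F
  closure-con {F} {S} F⊆E S⊆E = ⊆-antisym to from
    where
    rk-F≤ : ∀ {X} → X ⊆ E M → rk M F ≤ rk M (X ∪ F)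
    rk-F≤ X⊆E = rk-mono _ _ (q⊆p∪q _ F) (∪-least X⊆E F⊆E)
    to : closure (con M F) S ⊆ closure M (S ∪ F) ─ F
    to {x} m with ∈-closure⁻ (con M F) m
    ... | x∈E─F , eq = x∈p∧x∉q⇒x∈p─q (∈-closure⁺ M x∈E rk-eq) (x∈p─q⇒x∉q x∈E─F)
      where
      x∈E : x ∈ₛ E M
      x∈E = p─q⊆p _ F x∈E─F
      rk-eq : rk M ((S ∪ F) ∪ ⁅ x ⁆) ≡ rk M (S ∪ F)
      rk-eq = trans (cong (rk M) (sym ([p∪q]∪r≡[p∪r]∪q S ⁅ x ⁆ F)))
                    (ℕP.∸-cancelʳ-≡ (rk-F≤ (∪-least S⊆E (x∈p⇒⁅x⁆⊆p x∈E))) (rk-F≤ S⊆E) eq)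
    from : closure M (S ∪ F) ─ F ⊆ closure (con M F) S
    from {x} m with ∈-closure⁻ M (p─q⊆p _ F m)
    ... | x∈E , eq = ∈-closure⁺ (con M F) (x∈p∧x∉q⇒x∈p─q x∈E (x∈p─q⇒x∉q m))
                       (cong (_∸ rk M F) (trans (cong (rk M) ([p∪q]∪r≡[p∪r]∪q S ⁅ x ⁆ F)) eq))

  flat-con⁻ : ∀ {F S} → F ⊆ E M → IsFlat (con M F) S → S ∩ F ≡ ⊥ × IsFlat M (S ∪ F)
  flat-con⁻ {F} {S} F⊆E (S⊆E─F , closed) =
    x∉q⇒p∩q≡⊥ (λ x∈S → x∈p─q⇒x∉q (S⊆E─F x∈S)) , S∪F⊆E , ⊆-antisym shrink (⊆-closure S∪F⊆E)
    where
    S⊆E : S ⊆ E M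
    S⊆E = ⊆-trans S⊆E─F (p─q⊆p _ F)
    S∪F⊆E : S ∪ F ⊆ E M
    S∪F⊆E = ∪-least S⊆E F⊆E
    shrink : closure M (S ∪ F) ⊆ S ∪ F
    shrink m with x∈p∪q⁻ _ F (p⊆[p─q]∪q _ F m)
    ... | inj₁ x∈cl─F = p⊆p∪q F (subst (_ ∈ₛ_) (trans (sym (closure-con F⊆E S⊆E)) closed) x∈cl─F)
    ... | inj₂ x∈F    = q⊆p∪q S F x∈F

  flat-con⁺ : ∀ {F S} → F ⊆ E M → S ∩ F ≡ ⊥ → IsFlat M (S ∪ F) → IsFlat (con M F) S
  flat-con⁺ {F} {S} F⊆E disjoint (S∪F⊆E , closed) =
    S⊆E─F , trans (closure-con F⊆E S⊆E) (trans (cong (_─ F) closed) (p∩q≡⊥⇒[p∪q]─q≡p disjoint))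
    where
    S⊆E : S ⊆ E M
    S⊆E = ⊆-trans (p⊆p∪q F) S∪F⊆E
    S⊆E─F : S ⊆ E M ─ F
    S⊆E─F x∈S = x∈p∧x∉q⇒x∈p─q (S⊆E x∈S) (p∩q≡⊥⇒x∉q disjoint x∈S)

  ∑-flats-con : ∀ {F} → F ⊆ E M → (u : Subset N → ℤ) →
    ∑ (flats (con M F)) u ≡ ∑[ T ← flats M ] when? (F ⊆? T) (u (T ─ F))
  ∑-flats-con {F} F⊆E u = begin
    ∑ (flats (con M F)) u
      ≡⟨ ∑-flats (con M F) u ⟩
    ∑[ S ← allSubsets N ] when? (isFlat? (con M F) S) (u S)
      ≡⟨ ∑-cong (allSubsets N) flat-con⇔ ⟩
    ∑[ S ← allSubsets N ] when? (disjoint? S F) (g (S ∪ F))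
      ≡⟨ ∑-allSubsets-∪ F g ⟩
    ∑[ T ← allSubsets N ] when? (F ⊆? T) (g T)
      ≡⟨ ∑-cong (allSubsets N) (λ T → when-comm (does (F ⊆? T)) (does (isFlat? M T)) (u (T ─ F))) ⟩
    ∑[ T ← allSubsets N ] when? (isFlat? M T) (when? (F ⊆? T) (u (T ─ F)))
      ≡⟨ ∑-flats M _ ⟨
    ∑[ T ← flats M ] when? (F ⊆? T) (u (T ─ F)) ∎
    where
    open ≡-Reasoning
    g : Subset N → ℤ
    g T = when? (isFlat? M T) (u (T ─ F))
    flat-con⇔ : ∀ S → when? (isFlat? (con M F) S) (u S) ≡ when? (disjoint? S F) (g (S ∪ F))
    flat-con⇔ S = begin
      when? (isFlat? (con M F) S) (u S)
        ≡⟨ cong (λ b → when b (u S)) (does-⇔ (isFlat? (con M F) S) (disjoint? S F ×-dec isFlat? M (S ∪ F))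
                                            (flat-con⁻ F⊆E) (λ (d , fl) → flat-con⁺ F⊆E d fl)) ⟩
      when (does (disjoint? S F) ∧ does (isFlat? M (S ∪ F))) (u S)
        ≡⟨ when-∧ (does (disjoint? S F)) _ (u S) ⟩
      when? (disjoint? S F) (when? (isFlat? M (S ∪ F)) (u S))
        ≡⟨ when?-cong (disjoint? S F) (λ d → cong (when? (isFlat? M (S ∪ F)) ∘′ u) (sym (p∩q≡⊥⇒[p∪q]─q≡p d))) ⟩
      when? (disjoint? S F) (g (S ∪ F)) ∎

  flat-loc⁻ : ∀ {G S} → IsFlat M G → IsFlat (loc M G) S → S ⊆ G × IsFlat M S
  flat-loc⁻ {G} {S} G-flat (S⊆G , closed) = S⊆G , S⊆E , ⊆-antisym shrink (⊆-closure S⊆E)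
    where
    S⊆E : S ⊆ E M
    S⊆E = ⊆-trans S⊆G (proj₁ G-flat)
    shrink : closure M S ⊆ S
    shrink m = subst (_ ∈ₛ_) closed (∈-closure⁺ (loc M G) (closure-least G-flat S⊆G m) (rk-insert-closure m))

  flat-loc⁺ : ∀ {G S} → G ⊆ E M → S ⊆ G → IsFlat M S → IsFlat (loc M G) S
  flat-loc⁺ {G} {S} G⊆E S⊆G (S⊆E , closed) = S⊆G , ⊆-antisym shrink grow
    where
    shrink : closure (loc M G) S ⊆ S
    shrink m = subst (_ ∈ₛ_) closed (closure-loc⊆closure M G⊆E m)
    grow : S ⊆ closure (loc M G) S
    grow x∈S = ∈-closure⁺ (loc M G) (S⊆G x∈S) (rk-insert-closure (⊆-closure S⊆E x∈S))

  ∑-flats-loc : ∀ {G} → IsFlat M G → (u : Subset N → ℤ) →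
    ∑ (flats (loc M G)) u ≡ ∑[ S ← flats M ] when? (S ⊆? G) (u S)
  ∑-flats-loc {G} G-flat u = begin
    ∑ (flats (loc M G)) u
      ≡⟨ ∑-flats (loc M G) u ⟩
    ∑[ S ← allSubsets N ] when? (isFlat? (loc M G) S) (u S)
      ≡⟨ ∑-cong (allSubsets N) flat-loc⇔ ⟩
    ∑[ S ← allSubsets N ] when? (isFlat? M S) (when? (S ⊆? G) (u S))
      ≡⟨ ∑-flats M _ ⟨
    ∑[ S ← flats M ] when? (S ⊆? G) (u S) ∎
    where
    open ≡-Reasoning
    flat-loc⇔ : ∀ S → when? (isFlat? (loc M G) S) (u S) ≡ when? (isFlat? M S) (when? (S ⊆? G) (u S))
    flat-loc⇔ S = trans (cong (λ b → when b (u S))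
                           (does-⇔ (isFlat? (loc M G) S) (S ⊆? G ×-dec isFlat? M S)
                                   (flat-loc⁻ G-flat) (λ (S⊆G , fl) → flat-loc⁺ (proj₁ G-flat) S⊆G fl)))
                  (trans (when-∧ (does (S ⊆? G)) _ (u S)) (when-comm (does (S ⊆? G)) _ (u S)))

∑-interval : RankData N → Subset N → Subset N → (Subset N → ℤ) → ℤ
∑-interval D A G f = ∑[ H ← flats D ] when? (A ⊆? H) (when? (H ⊆? G) (f H))

δ : Subset N → Subset N → ℤ
δ A G = when? (A ≟ₛ G) (+ 1)

∑-interval-cong : (D : RankData N) (A G : Subset N) {f g : Subset N → ℤ} →
  (∀ H → IsFlat D H → A ⊆ H → H ⊆ G → f H ≡ g H) → ∑-interval D A G f ≡ ∑-interval D A G g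
∑-interval-cong D A G e = ∑-cong-∈ (flats D) λ H m →
  when?-cong (A ⊆? H) (λ A⊆H → when?-cong (H ⊆? G) (e H (∈flats⇒IsFlat {M = D} m) A⊆H))

∑-interval-split : (D : RankData N) {A G : Subset N} (f : Subset N → ℤ) (K : Subset N) → IsFlat D K →
  ∑-interval D A G f ≡ when? (A ⊆? K) (when? (K ⊆? G) (f K)) + ∑-interval D A G (λ H → when? (¬? (H ≟ₛ K)) (f H))
∑-interval-split {N} D {A} {G} f K K-flat = begin
  ∑-interval D A G f
    ≡⟨ ∑-cong (flats D) (λ H → cong (λ z → when? (A ⊆? H) (when? (H ⊆? G) z)) (when?-split (H ≟ₛ K) (f H))) ⟩
  ∑[ H ← flats D ] whens H (when? (H ≟ₛ K) (f H) + when? (¬? (H ≟ₛ K)) (f H))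
    ≡⟨ ∑-cong (flats D) (λ H → trans (cong (when? (A ⊆? H)) (when-+ (does (H ⊆? G)) _ _)) (when-+ (does (A ⊆? H)) _ _)) ⟩
  ∑[ H ← flats D ] (whens H (when? (H ≟ₛ K) (f H)) + whens H (when? (¬? (H ≟ₛ K)) (f H)))
    ≡⟨ ∑-+ (flats D) _ _ ⟩
  (∑[ H ← flats D ] whens H (when? (H ≟ₛ K) (f H))) + ∑-interval D A G (λ H → when? (¬? (H ≟ₛ K)) (f H))
    ≡⟨ cong (_+ ∑-interval D A G (λ H → when? (¬? (H ≟ₛ K)) (f H)))
            (trans (∑-cong (flats D) pull) (∑-flats-δ D _ K-flat)) ⟩
  whens K (f K) + ∑-interval D A G (λ H → when? (¬? (H ≟ₛ K)) (f H)) ∎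
  where
  open ≡-Reasoning
  whens : Subset N → ℤ → ℤ
  whens H x = when? (A ⊆? H) (when? (H ⊆? G) x)
  pull : ∀ H → whens H (when? (H ≟ₛ K) (f H)) ≡ when? (H ≟ₛ K) (whens H (f H))
  pull H = trans (cong (when? (A ⊆? H)) (when-comm (does (H ⊆? G)) (does (H ≟ₛ K)) _))
                 (when-comm (does (A ⊆? H)) (does (H ≟ₛ K)) _)

∑-interval-single : (D : RankData N) {A G : Subset N} (f : Subset N → ℤ) (K : Subset N) → IsFlat D K → A ⊆ K → K ⊆ G →
  (∀ H → IsFlat D H → A ⊆ H → H ⊆ G → ¬ H ≡ K → f H ≡ + 0) → ∑-interval D A G f ≡ f K
∑-interval-single {N} D {A} {G} f K K-flat A⊆K K⊆G vanish = begin
  ∑-interval D A G f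
    ≡⟨ ∑-interval-split D {A} {G} f K K-flat ⟩
  when? (A ⊆? K) (when? (K ⊆? G) (f K)) + ∑-interval D A G (λ H → when? (¬? (H ≟ₛ K)) (f H))
    ≡⟨ cong₂ _+_ (trans (when?-yes (A ⊆? K) _ A⊆K) (when?-yes (K ⊆? G) _ K⊆G))
                 (trans (∑-interval-cong D A G rest) (∑-cong (flats D) λ H →
                   trans (cong (when? (A ⊆? H)) (when-zero (does (H ⊆? G)))) (when-zero (does (A ⊆? H))))) ⟩
  f K + (∑[ H ← flats D ] + 0)
    ≡⟨ cong (_+_ (f K)) (∑-zero (flats D)) ⟩
  f K + + 0
    ≡⟨ ℤP.+-identityʳ (f K) ⟩
  f K ∎
  where
  open ≡-Reasoning
  rest : ∀ H → IsFlat D H → A ⊆ H → H ⊆ G → when? (¬? (H ≟ₛ K)) (f H) ≡ + 0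
  rest H H-flat A⊆H H⊆G = trans (when?-cong (¬? (H ≟ₛ K)) (vanish H H-flat A⊆H H⊆G)) (when-zero _)

∑-interval-when : (D : RankData N) {A G : Subset N} (b : Bool) (f : Subset N → ℤ) →
  ∑-interval D A G (λ H → when b (f H)) ≡ when b (∑-interval D A G f)
∑-interval-when D {A} {G} b f =
  trans (∑-cong (flats D) λ H → trans (cong (when? (A ⊆? H)) (when-comm (does (H ⊆? G)) b (f H)))
                                      (when-comm (does (A ⊆? H)) b _))
        (∑-when b (flats D) _)

∑-interval-*ˡ : (D : RankData N) {A G : Subset N} (c : ℤ) (f : Subset N → ℤ) →
  ∑-interval D A G (λ H → c * f H) ≡ c * ∑-interval D A G f
∑-interval-*ˡ D {A} {G} c f =
  trans (∑-cong (flats D) λ H → sym (trans (when-*ˡ (does (A ⊆? H)) c _)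
                                           (cong (when? (A ⊆? H)) (when-*ˡ (does (H ⊆? G)) c (f H)))))
        (∑-*ˡ (flats D) c _)

∑-interval-*ʳ : (D : RankData N) {A G : Subset N} (f : Subset N → ℤ) (c : ℤ) →
  ∑-interval D A G (λ H → f H * c) ≡ ∑-interval D A G f * c
∑-interval-*ʳ D {A} {G} f c =
  trans (∑-cong (flats D) λ H → sym (trans (when-*ʳ (does (A ⊆? H)) _ c)
                                           (cong (when? (A ⊆? H)) (when-*ʳ (does (H ⊆? G)) (f H) c))))
        (∑-*ʳ (flats D) _ c)

-- Both sides sum w over the chains A ≤ K ≤ F ≤ H.
∑-interval-swap : (D : RankData N) {A H : Subset N} (w : Subset N → Subset N → ℤ) →
  ∑-interval D A H (λ K → ∑-interval D K H (w K)) ≡ ∑-interval D A H (λ F → ∑-interval D A F (λ K → w K F))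
∑-interval-swap {N} D {A} {H} w = begin
  ∑-interval D A H (λ K → ∑-interval D K H (w K))
    ≡⟨ ∑-cong Fl (λ K → trans (cong (when? (A ⊆? K)) (sym (∑-when (does (K ⊆? H)) Fl _)))
                              (sym (∑-when (does (A ⊆? K)) Fl _))) ⟩
  ∑[ K ← Fl ] ∑[ F ← Fl ] chain K F
    ≡⟨ ∑-swap Fl Fl chain ⟩
  ∑[ F ← Fl ] ∑[ K ← Fl ] chain K F
    ≡⟨ ∑-cong Fl (λ F → ∑-cong Fl (λ K → regroup K F)) ⟩
  ∑[ F ← Fl ] ∑[ K ← Fl ] when? (A ⊆? F) (when? (F ⊆? H) (when? (A ⊆? K) (when? (K ⊆? F) (w K F))))
    ≡⟨ ∑-cong Fl (λ F → trans (∑-when (does (A ⊆? F)) Fl _) (cong (when? (A ⊆? F)) (∑-when (does (F ⊆? H)) Fl _))) ⟩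
  ∑-interval D A H (λ F → ∑-interval D A F (λ K → w K F)) ∎
  where
  open ≡-Reasoning
  Fl : List (Subset N)
  Fl = flats D
  chain : Subset N → Subset N → ℤ
  chain K F = when? (A ⊆? K) (when? (K ⊆? H) (when? (K ⊆? F) (when? (F ⊆? H) (w K F))))
  regroup : ∀ K F → chain K F ≡ when? (A ⊆? F) (when? (F ⊆? H) (when? (A ⊆? K) (when? (K ⊆? F) (w K F))))
  regroup K F with A ⊆? K | K ⊆? F | F ⊆? H
  ... | no _    | _       | F⊆?H    = sym (trans (cong (when? (A ⊆? F)) (when-zero (does F⊆?H)))
                                                 (when-zero (does (A ⊆? F))))
  ... | yes _   | no _    | F⊆?H    = trans (when-zero (does (K ⊆? H)))
                                        (sym (trans (cong (when? (A ⊆? F)) (when-zero (does F⊆?H)))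
                                                    (when-zero (does (A ⊆? F)))))
  ... | yes _   | yes _   | no _    = trans (when-zero (does (K ⊆? H))) (sym (when-zero (does (A ⊆? F))))
  ... | yes A⊆K | yes K⊆F | yes F⊆H =
    trans (when?-yes (K ⊆? H) _ (⊆-trans K⊆F F⊆H)) (sym (when?-yes (A ⊆? F) _ (⊆-trans A⊆K K⊆F)))

module Mobius (D : RankData N) where

  mobius-refl : ∀ k A → mobiusFuel D k A A ≡ + 1
  mobius-refl k A with A ≟ₛ A
  mobius-refl zero    A | yes _ = refl
  mobius-refl (suc k) A | yes _ = refl
  ... | no A≢A = contradiction refl A≢A

  mobius-zero : ∀ {A G} → ¬ A ≡ G → mobiusFuel D zero A G ≡ + 0
  mobius-zero {A} {G} A≢G with A ≟ₛ G
  ... | yes A≡G = contradiction A≡G A≢G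
  ... | no _    = refl

  mobius-suc : ∀ k {A G} → ¬ A ≡ G →
    mobiusFuel D (suc k) A G ≡ - ∑-interval D A G (λ H → when? (¬? (H ≟ₛ G)) (mobiusFuel D k A H))
  mobius-suc k {A} {G} A≢G with A ≟ₛ G
  ... | yes A≡G = contradiction A≡G A≢G
  ... | no _    = cong -_ (trans (∑-filter _ (flats D) (mobiusFuel D k A))
                            (∑-cong (flats D) λ H → trans (when-∧ (does (A ⊆? H)) _ _)
                                                         (cong (when? (A ⊆? H)) (when-∧ (does (H ⊆? G)) _ _))))

  -- Enough fuel: a strict chain of flats ending in H has at most ∣ H ∣ steps.
  mobiusFuel-stable : ∀ k {A H} → ∣ H ∣ ≤ k → mobiusFuel D k A H ≡ mobiusFuel D (suc k) A H
  mobiusFuel-stable k {A} {H} ∣H∣≤k = by-cases k ∣H∣≤k (A ≟ₛ H)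
    where
    by-cases : ∀ k {H} → ∣ H ∣ ≤ k → Dec (A ≡ H) → mobiusFuel D k A H ≡ mobiusFuel D (suc k) A H
    by-cases k _ (yes refl) = trans (mobius-refl k A) (sym (mobius-refl (suc k) A))
    by-cases zero {H} ∣H∣≤0 (no A≢H) =
      trans (mobius-zero A≢H) (sym (trans (mobius-suc zero A≢H) (cong -_ (trans (∑-cong (flats D) vanish)
                                                                               (∑-zero (flats D))))))
      where
      vanish : ∀ H′ → when? (A ⊆? H′) (when? (H′ ⊆? H) (when? (¬? (H′ ≟ₛ H)) (mobiusFuel D zero A H′))) ≡ + 0
      vanish H′ with A ⊆? H′ | H′ ⊆? H | H′ ≟ₛ H
      ... | yes _ | yes H′⊆H | no H′≢H = contradiction (ℕP.<-≤-trans (⊆∧≢⇒∣p∣<∣q∣ H′⊆H H′≢H) ∣H∣≤0) ℕP.n≮0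
      ... | yes _ | yes _    | yes _   = refl
      ... | yes _ | no _     | _       = refl
      ... | no _  | _        | _       = refl
    by-cases (suc k) {H} ∣H∣≤k (no A≢H) =
      trans (mobius-suc k A≢H) (trans (cong -_ (∑-interval-cong D A H step)) (sym (mobius-suc (suc k) A≢H)))
      where
      step : ∀ H′ → IsFlat D H′ → A ⊆ H′ → H′ ⊆ H →
        when? (¬? (H′ ≟ₛ H)) (mobiusFuel D k A H′) ≡ when? (¬? (H′ ≟ₛ H)) (mobiusFuel D (suc k) A H′)
      step H′ _ _ H′⊆H = when?-cong (¬? (H′ ≟ₛ H)) λ H′≢H →
        by-cases k (ℕP.≤-pred (ℕP.<-≤-trans (⊆∧≢⇒∣p∣<∣q∣ H′⊆H H′≢H) ∣H∣≤k)) (A ≟ₛ H′)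

open Mobius

mobius-recursion : (D : RankData N) {A G : Subset N} → ¬ A ≡ G →
  mobius D A G ≡ - ∑-interval D A G (λ H → when? (¬? (H ≟ₛ G)) (mobius D A H))
mobius-recursion {zero}  D {[]} {[]} A≢G = contradiction refl A≢G
mobius-recursion {suc k} D {A} {G} A≢G =
  trans (mobius-suc D k A≢G) (cong -_ (∑-interval-cong D A G stable))
  where
  stable : ∀ H → IsFlat D H → A ⊆ H → H ⊆ G →
    when? (¬? (H ≟ₛ G)) (mobiusFuel D k A H) ≡ when? (¬? (H ≟ₛ G)) (mobius D A H)
  stable H _ _ H⊆G = when?-cong (¬? (H ≟ₛ G)) λ H≢G →
    mobiusFuel-stable D k {A} {H} (ℕP.≤-pred (ℕP.<-≤-trans (⊆∧≢⇒∣p∣<∣q∣ H⊆G H≢G) (∣p∣≤n G)))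

∑-interval-mobiusˡ : (D : RankData N) {A G : Subset N} → IsFlat D A → IsFlat D G → A ⊆ G →
  ∑-interval D A G (mobius D A) ≡ δ A G
∑-interval-mobiusˡ D {A} {G} A-flat G-flat A⊆G with A ≟ₛ G
... | yes refl = trans (∑-interval-single D (mobius D A) A A-flat ⊆-refl ⊆-refl
                          (λ H _ A⊆H H⊆A H≢A → contradiction (⊆-antisym H⊆A A⊆H) H≢A))
                       (mobius-refl D _ A)
... | no A≢G = begin
  ∑-interval D A G (mobius D A)
    ≡⟨ ∑-interval-split D {A} {G} (mobius D A) G G-flat ⟩
  when? (A ⊆? G) (when? (G ⊆? G) (mobius D A G)) + ∑-interval D A G (λ H → when? (¬? (H ≟ₛ G)) (mobius D A H))
    ≡⟨ cong₂ _+_ (trans (when?-yes (A ⊆? G) _ A⊆G) (when?-yes (G ⊆? G) _ ⊆-refl))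
                 (sym (trans (cong -_ (mobius-recursion D A≢G)) (ℤP.neg-involutive _))) ⟩
  mobius D A G - mobius D A G
    ≡⟨ ℤP.+-inverseʳ (mobius D A G) ⟩
  + 0 ∎
  where open ≡-Reasoning

∑-interval-mobiusʳ-refl : (D : RankData N) {A : Subset N} → IsFlat D A → ∑-interval D A A (λ F → mobius D F A) ≡ + 1
∑-interval-mobiusʳ-refl D {A} A-flat =
  trans (∑-interval-single D (λ F → mobius D F A) A A-flat ⊆-refl ⊆-refl
           (λ F _ A⊆F F⊆A F≢A → contradiction (⊆-antisym F⊆A A⊆F) F≢A))
        (mobius-refl D _ A)

-- Both sides evaluate ∑_{A ≤ K ≤ H} μ(A,K) ∑_{K ≤ F ≤ H} μ(F,H), the second one assuming the
-- identity for the intervals [K,H] with A < K.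
private
  double-sum-left : (D : RankData N) {A H : Subset N} → IsFlat D A → A ⊆ H →
    ∑-interval D A H (λ K → mobius D A K * ∑-interval D K H (λ F → mobius D F H)) ≡ mobius D A H
  double-sum-left D {A} {H} A-flat A⊆H = begin
    ∑-interval D A H (λ K → mobius D A K * ∑-interval D K H (λ F → mobius D F H))
      ≡⟨ ∑-interval-cong D A H (λ K _ _ _ → sym (∑-interval-*ˡ D {K} {H} (mobius D A K) (λ F → mobius D F H))) ⟩
    ∑-interval D A H (λ K → ∑-interval D K H (λ F → mobius D A K * mobius D F H))
      ≡⟨ ∑-interval-swap D {A} {H} (λ K F → mobius D A K * mobius D F H) ⟩
    ∑-interval D A H (λ F → ∑-interval D A F (λ K → mobius D A K * mobius D F H))
      ≡⟨ ∑-interval-cong D A H (λ F _ _ _ → ∑-interval-*ʳ D {A} {F} (mobius D A) (mobius D F H)) ⟩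
    ∑-interval D A H (λ F → ∑-interval D A F (mobius D A) * mobius D F H)
      ≡⟨ ∑-interval-cong D A H (λ F F-flat A⊆F _ → cong (_* mobius D F H) (∑-interval-mobiusˡ D A-flat F-flat A⊆F)) ⟩
    ∑-interval D A H (λ F → δ A F * mobius D F H)
      ≡⟨ ∑-interval-single D {A} {H} _ A A-flat ⊆-refl A⊆H
           (λ F _ _ _ F≢A → cong (_* mobius D F H) (when?-no (A ≟ₛ F) (+ 1) (F≢A ∘′ sym))) ⟩
    δ A A * mobius D A H
      ≡⟨ cong (_* mobius D A H) (when?-yes (A ≟ₛ A) _ refl) ⟩
    + 1 * mobius D A H
      ≡⟨ ℤP.*-identityˡ _ ⟩
    mobius D A H ∎
    where open ≡-Reasoning

  double-sum-right : (D : RankData N) {A H : Subset N} → IsFlat D A → IsFlat D H → A ⊆ H → ¬ A ≡ H →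
    (∀ K → IsFlat D K → A ⊆ K → K ⊆ H → ¬ K ≡ A → ∑-interval D K H (λ F → mobius D F H) ≡ δ K H) →
    ∑-interval D A H (λ K → mobius D A K * ∑-interval D K H (λ F → mobius D F H))
      ≡ ∑-interval D A H (λ F → mobius D F H) + mobius D A H
  double-sum-right {N} D {A} {H} A-flat H-flat A⊆H A≢H smaller = begin
    ∑-interval D A H (λ K → mobius D A K * R K)
      ≡⟨ ∑-interval-split D {A} {H} _ A A-flat ⟩
    when? (A ⊆? A) (when? (A ⊆? H) (mobius D A A * R A))
      + ∑-interval D A H (λ K → when? (¬? (K ≟ₛ A)) (mobius D A K * R K))
      ≡⟨ cong₂ _+_ (trans (when?-yes (A ⊆? A) _ ⊆-refl) (trans (when?-yes (A ⊆? H) _ A⊆H)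
                     (trans (cong (_* R A) (mobius-refl D _ A)) (ℤP.*-identityˡ (R A)))))
                   (∑-interval-single D {A} {H} _ H H-flat A⊆H ⊆-refl vanish) ⟩
    R A + when? (¬? (H ≟ₛ A)) (mobius D A H * R H)
      ≡⟨ cong (_+_ (R A)) (trans (when?-yes (¬? (H ≟ₛ A)) _ (A≢H ∘′ sym))
                                 (trans (cong (mobius D A H *_) (∑-interval-mobiusʳ-refl D H-flat)) (ℤP.*-identityʳ _))) ⟩
    R A + mobius D A H ∎
    where
    open ≡-Reasoning
    R : Subset N → ℤ
    R K = ∑-interval D K H (λ F → mobius D F H)
    vanish : ∀ K → IsFlat D K → A ⊆ K → K ⊆ H → ¬ K ≡ H → when? (¬? (K ≟ₛ A)) (mobius D A K * R K) ≡ + 0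
    vanish K K-flat A⊆K K⊆H K≢H = trans (when?-cong (¬? (K ≟ₛ A)) λ K≢A →
      trans (cong (mobius D A K *_) (trans (smaller K K-flat A⊆K K⊆H K≢A) (when?-no (K ≟ₛ H) _ K≢H)))
            (ℤP.*-zeroʳ (mobius D A K))) (when-zero _)

∑-interval-mobiusʳ-≤ : (D : RankData N) (m : ℕ) {A H : Subset N} → ∣ H ∣ ≤ m ℕ.+ ∣ A ∣ →
  IsFlat D A → IsFlat D H → A ⊆ H → ∑-interval D A H (λ F → mobius D F H) ≡ δ A H
∑-interval-mobiusʳ-≤ D m {A} {H} size A-flat H-flat A⊆H with A ≟ₛ H
... | yes refl = ∑-interval-mobiusʳ-refl D A-flat
... | no A≢H = identityˡ-unique _ (mobius D A H)
                 (trans (sym (double-sum-right D A-flat H-flat A⊆H A≢H (smaller m size))) (double-sum-left D A-flat A⊆H))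
  where
  smaller : ∀ m → ∣ H ∣ ≤ m ℕ.+ ∣ A ∣ → ∀ K → IsFlat D K → A ⊆ K → K ⊆ H → ¬ K ≡ A →
            ∑-interval D K H (λ F → mobius D F H) ≡ δ K H
  smaller zero    size K _      A⊆K K⊆H K≢A =
    contradiction (ℕP.<-≤-trans (⊆∧≢⇒∣p∣<∣q∣ A⊆K (K≢A ∘′ sym)) (p⊆q⇒∣p∣≤∣q∣ K⊆H)) (ℕP.≤⇒≯ size)
  smaller (suc m) size K K-flat A⊆K K⊆H K≢A = ∑-interval-mobiusʳ-≤ D m size′ K-flat H-flat K⊆H
    where
    size′ : ∣ H ∣ ≤ m ℕ.+ ∣ K ∣
    size′ = ℕP.≤-trans size (ℕP.≤-trans (ℕP.≤-reflexive (sym (ℕP.+-suc m ∣ A ∣)))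
                                        (ℕP.+-monoʳ-≤ m (⊆∧≢⇒∣p∣<∣q∣ A⊆K (K≢A ∘′ sym))))

∑-interval-mobiusʳ : (D : RankData N) {A H : Subset N} → IsFlat D A → IsFlat D H → A ⊆ H →
  ∑-interval D A H (λ F → mobius D F H) ≡ δ A H
∑-interval-mobiusʳ D {A} {H} = ∑-interval-mobiusʳ-≤ D ∣ H ∣ (ℕP.m≤m+n ∣ H ∣ ∣ A ∣)

record Agree (D D′ : RankData N) : Set where
  field
    E-≡  : E D ≡ E D′
    rk-≡ : ∀ S → S ⊆ E D → rk D S ≡ rk D′ S

mobiusFuel-flats-≡ : {D D′ : RankData N} → flats D ≡ flats D′ → ∀ k A B → mobiusFuel D k A B ≡ mobiusFuel D′ k A B
mobiusFuel-flats-≡ {N} {D} {D′} flats-≡ k A B = by-cases k B (A ≟ₛ B)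
  where
  by-cases : ∀ k B → Dec (A ≡ B) → mobiusFuel D k A B ≡ mobiusFuel D′ k A B
  by-cases k       B (yes refl) = trans (mobius-refl D k A) (sym (mobius-refl D′ k A))
  by-cases zero    B (no A≢B)   = trans (mobius-zero D A≢B) (sym (mobius-zero D′ A≢B))
  by-cases (suc k) B (no A≢B)   =
    trans (mobius-suc D k A≢B)
      (trans (cong (λ Fl → - (∑[ H ← Fl ] when? (A ⊆? H) (when? (H ⊆? B)
                                             (when? (¬? (H ≟ₛ B)) (mobiusFuel D k A H)))))
                   flats-≡)
        (trans (cong -_ (∑-cong (flats D′) λ H →
                 cong (λ z → when? (A ⊆? H) (when? (H ⊆? B) (when? (¬? (H ≟ₛ B)) z))) (by-cases k H (A ≟ₛ H))))
          (sym (mobius-suc D′ k A≢B))))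

module Agreement {D D′ : RankData N} (agree : Agree D D′) where
  open Agree agree

  closure-≡ : ∀ {S} → S ⊆ E D → closure D S ≡ closure D′ S
  closure-≡ {S} S⊆E = VecP.tabulate-cong pointwise
    where
    pointwise : ∀ x → lookup (E D) x ∧ (rk D (S ∪ ⁅ x ⁆) ≡ᵇ rk D S) ≡ lookup (E D′) x ∧ (rk D′ (S ∪ ⁅ x ⁆) ≡ᵇ rk D′ S)
    pointwise x rewrite sym E-≡ with lookup (E D) x in x∈E
    ... | false = refl
    ... | true  = cong₂ _≡ᵇ_ (rk-≡ _ (∪-least S⊆E (x∈p⇒⁅x⁆⊆p (lookup⇒∈ x∈E)))) (rk-≡ S S⊆E)

  flats-≡ : flats D ≡ flats D′
  flats-≡ = ListP.filter-≐ (isFlat? D) (isFlat? D′) (to , from) (allSubsets N)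
    where
    to : ∀ {S} → IsFlat D S → IsFlat D′ S
    to {S} (S⊆E , closed) = subst (S ⊆_) E-≡ S⊆E , trans (sym (closure-≡ S⊆E)) closed
    from : ∀ {S} → IsFlat D′ S → IsFlat D S
    from {S} (S⊆E′ , closed) = S⊆E , trans (closure-≡ S⊆E) closed
      where
      S⊆E : S ⊆ E D
      S⊆E = subst (S ⊆_) (sym E-≡) S⊆E′

  rank-≡ : rank D ≡ rank D′
  rank-≡ = trans (rk-≡ (E D) ⊆-refl) (cong (rk D′) E-≡)

  χ-≡ : ∀ i → χ D i ≡ χ D′ i
  χ-≡ i = trans (cong (λ Fl → ∑[ F ← Fl ] term D F) flats-≡) (∑-cong-∈ (flats D′) λ F m →
            cong₂ when
              (cong₂ (λ r s → r ∸ s ≡ᵇ i) rank-≡ (rk-≡ F (F⊆E m)))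
              (trans (cong (λ Z → mobius D Z F) (closure-≡ (⊆-min _)))
                     (mobiusFuel-flats-≡ {D = D} {D′} flats-≡ N (zeroHat D′) F)))
    where
    term : RankData N → Subset N → ℤ
    term D″ F = when (crk D″ F ≡ᵇ i) (mobius D″ (zeroHat D″) F)
    F⊆E : ∀ {F} → F ∈ flats D′ → F ⊆ E D
    F⊆E m = subst (_ ⊆_) (sym E-≡) (proj₁ (∈flats⇒IsFlat {M = D′} m))

  loc-agree : ∀ {G} → G ⊆ E D → Agree (loc D G) (loc D′ G)
  loc-agree G⊆E = record { E-≡ = refl ; rk-≡ = λ S S⊆G → rk-≡ S (⊆-trans S⊆G G⊆E) }

  con-agree : ∀ {F} → F ⊆ E D → Agree (con D F) (con D′ F)
  con-agree {F} F⊆E = record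
    { E-≡  = cong (_─ F) E-≡
    ; rk-≡ = λ S S⊆ → cong₂ _∸_ (rk-≡ (S ∪ F) (∪-least (⊆-trans S⊆ (p─q⊆p _ F)) F⊆E)) (rk-≡ F F⊆E)
    }

coef-∸ : (p : Poly) {i k : ℕ} → k ≤ i → coef p (+ i - + k) ≡ p (i ∸ k)
coef-∸ p {i} {k} k≤i rewrite ℤP.m-n≡m⊖n i k | ℤP.⊖-≥ k≤i = refl

coef-∸-when : (p : Poly) (i k : ℕ) → coef p (+ i - + k) ≡ when? (k ℕ.≤? i) (p (i ∸ k))
coef-∸-when p i k = by-cases (k ℕ.≤? i)
  where
  by-cases : (d : Dec (k ≤ i)) → coef p (+ i - + k) ≡ when? d (p (i ∸ k))
  by-cases (yes k≤i) = coef-∸ p k≤i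
  by-cases (no k≰i) rewrite ℤP.m-n≡m⊖n i k | ℤP.⊖-< (ℕP.≰⇒> k≰i) with k ∸ i in eq
  ... | zero  = contradiction (ℕP.m∸n≡0⇒m≤n eq) k≰i
  ... | suc _ = refl

*ₚ-cong : {p p′ q q′ : Poly} → (∀ a → p a ≡ p′ a) → (∀ a → q a ≡ q′ a) → ∀ n → (p *ₚ q) n ≡ (p′ *ₚ q′) n
*ₚ-cong p≗p′ q≗q′ n = ∑-cong (upTo (suc n)) (λ a → cong₂ _*_ (p≗p′ a) (q≗q′ (n ∸ a)))

∑-applyUpTo-zero : ∀ m (g : ℕ → ℕ) (h : ℕ → ℤ) → (∀ x → h (g x) ≡ + 0) → ∑ (applyUpTo g m) h ≡ + 0
∑-applyUpTo-zero zero    g h vanish = refl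
∑-applyUpTo-zero (suc m) g h vanish = cong₂ _+_ (vanish 0) (∑-applyUpTo-zero m (g ∘′ suc) h (λ x → vanish (suc x)))

*ₚ-constˡ : (p q : Poly) → (∀ a → p (suc a) ≡ + 0) → ∀ n → (p *ₚ q) n ≡ p 0 * q n
*ₚ-constˡ p q p-const n =
  trans (cong (_+_ (p 0 * q n)) (∑-applyUpTo-zero n suc (λ a → p a * q (n ∸ a))
                                   (λ a → cong (_* q (n ∸ suc a)) (p-const a))))
        (ℤP.+-identityʳ _)

∑-upTo-δ : ∀ m k (f : ℕ → ℤ) → ∑[ a ← upTo m ] when (k ≡ᵇ a) (f a) ≡ when? (k ℕ.<? m) (f k)
∑-upTo-δ zero    k f = sym (when?-no (k ℕ.<? 0) (f k) (λ ()))
∑-upTo-δ (suc m) k f = begin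
  ∑ (upTo (suc m)) g           ≡⟨ cong (λ xs → ∑ xs g) (sym (ListP.applyUpTo-∷ʳ (λ x → x) m)) ⟩
  ∑ (upTo m ∷ʳ m) g            ≡⟨ ∑-++ (upTo m) (m ∷ []) g ⟩
  ∑ (upTo m) g + (g m + + 0)   ≡⟨ cong₂ _+_ (∑-upTo-δ m k f) (ℤP.+-identityʳ (g m)) ⟩
  when? (k ℕ.<? m) (f k) + g m ≡⟨ last-term (ℕP.<-cmp k m) ⟩
  when? (k ℕ.<? suc m) (f k)   ∎
  where
  open ≡-Reasoning
  g : ℕ → ℤ
  g a = when (k ≡ᵇ a) (f a)
  ≡ᵇ-false : ¬ k ≡ m → (k ≡ᵇ m) ≡ false
  ≡ᵇ-false k≢m with k ≡ᵇ m in eq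
  ... | false = refl
  ... | true  = contradiction (≡ᵇ-true⇒≡ eq) k≢m
  last-term : Tri (k < m) (k ≡ m) (m < k) → when? (k ℕ.<? m) (f k) + g m ≡ when? (k ℕ.<? suc m) (f k)
  last-term (tri< k<m k≢m _)
    rewrite when?-yes (k ℕ.<? m) (f k) k<m | ≡ᵇ-false k≢m | when?-yes (k ℕ.<? suc m) (f k) (ℕP.m<n⇒m<1+n k<m)
    = ℤP.+-identityʳ _
  last-term (tri≈ k≮k refl _)
    rewrite when?-no (k ℕ.<? k) (f k) k≮k | ≡⇒≡ᵇ-true {k} refl | when?-yes (k ℕ.<? suc k) (f k) (ℕP.n<1+n k)
    = ℤP.+-identityˡ _
  last-term (tri> k≮m k≢m m<k)
    rewrite when?-no (k ℕ.<? m) (f k) k≮m | ≡ᵇ-false k≢m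
          | when?-no (k ℕ.<? suc m) (f k) (λ k<1+m → ℕP.<⇒≱ m<k (ℕP.≤-pred k<1+m))
    = refl

χ-rank-zero : (D : RankData N) → rank D ≡ 0 → ∀ a → χ D (suc a) ≡ + 0
χ-rank-zero D r≡0 a = trans (∑-cong (flats D) term-zero) (∑-zero (flats D))
  where
  term-zero : ∀ G → when (crk D G ≡ᵇ suc a) (mobius D (zeroHat D) G) ≡ + 0
  term-zero G rewrite r≡0 | ℕP.0∸n≡0 (rk D G) = refl

∸-half : ∀ {r j} → ¬ r ≤ 2 ℕ.* j → j ≤ r × r ≤ 2 ℕ.* (r ∸ j)
∸-half {r} {j} r≰2j = j≤r , r≤2[r∸j]
  where
  2j≤r : j ℕ.+ j ≤ r
  2j≤r = subst (_≤ r) (cong (j ℕ.+_) (ℕP.+-identityʳ j)) (ℕP.<⇒≤ (ℕP.≰⇒> r≰2j))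
  j≤r : j ≤ r
  j≤r = ℕP.≤-trans (ℕP.m≤m+n j j) 2j≤r
  r≤2[r∸j] : r ≤ 2 ℕ.* (r ∸ j)
  r≤2[r∸j] = begin
    r                     ≡⟨ ℕP.m∸n+n≡m j≤r ⟨
    (r ∸ j) ℕ.+ j         ≤⟨ ℕP.+-monoʳ-≤ (r ∸ j) (ℕP.m+n≤o⇒m≤o∸n j 2j≤r) ⟩
    (r ∸ j) ℕ.+ (r ∸ j)   ≡⟨ cong ((r ∸ j) ℕ.+_) (ℕP.+-identityʳ (r ∸ j)) ⟨
    2 ℕ.* (r ∸ j)         ∎
    where open ℕP.≤-Reasoning

module KazhdanLusztig (P : RankData N → Poly) (isKL : IsKL P) where

  P-rank-zero : ∀ {D} → IsMatroid D → rank D ≡ 0 → ∀ j → P D j ≡ when (j ≡ᵇ 0) (+ 1)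
  P-rank-zero {D} isM r≡0 zero    = proj₁ (proj₁ (isKL D isM) r≡0)
  P-rank-zero {D} isM r≡0 (suc j) = proj₂ (proj₁ (isKL D isM) r≡0) j

  P-vanish : ∀ {D j} → IsMatroid D → 0 < rank D → rank D ≤ 2 ℕ.* j → P D j ≡ + 0
  P-vanish {D} {j} isM 0<r r≤2j = proj₁ (proj₂ (isKL D isM)) 0<r j r≤2j

  KL-recursion : ∀ {D} → IsMatroid D → ∀ n →
    coef (P D) (+ rank D - + n) ≡ ∑[ F ← flats D ] (χ (loc D F) *ₚ P (con D F)) n
  KL-recursion {D} isM = proj₂ (proj₂ (isKL D isM))

  KL-recursion-at : ∀ {D j} → IsMatroid D → j ≤ rank D →
    P D j ≡ ∑[ F ← flats D ] (χ (loc D F) *ₚ P (con D F)) (rank D ∸ j)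
  KL-recursion-at {D} {j} isM j≤r =
    trans (cong (P D) (sym (ℕP.m∸[m∸n]≡n j≤r)))
          (trans (sym (coef-∸ (P D) (ℕP.m∸n≤m (rank D) j))) (KL-recursion isM (rank D ∸ j)))

  -- A flat of rank 0 leaves the constant χ of its localization times a coefficient of P(M^F) above its degree.
  recursion-term-rank-zero : ∀ {D F n} → IsMatroid D → F ⊆ E D → rk D F ≡ 0 → 0 < rank D → rank D ≤ 2 ℕ.* n →
    (χ (loc D F) *ₚ P (con D F)) n ≡ + 0
  recursion-term-rank-zero {D} {F} {n} isD F⊆E rk≡0 0<r r≤2n =
    trans (*ₚ-constˡ (χ (loc D F)) (P (con D F)) (χ-rank-zero (loc D F) rk≡0) n)
          (trans (cong (χ (loc D F) 0 *_) (P-vanish (con-isMatroid F⊆E) (subst (0 <_) (sym rank-eq) 0<r)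
                                                                      (subst (_≤ 2 ℕ.* n) (sym rank-eq) r≤2n)))
                 (ℤP.*-zeroʳ (χ (loc D F) 0)))
    where
    open Contraction D isD
    rank-eq : rank (con D F) ≡ rank D
    rank-eq = trans (rank-con F⊆E) (cong (rank D ∸_) rk≡0)

  P-above-rank : ∀ {D j} → IsMatroid D → rank D < j → P D j ≡ + 0
  P-above-rank {D} {suc j} isD r<j with rank D ℕ.≟ 0
  ... | yes r≡0 = P-rank-zero isD r≡0 (suc j)
  ... | no  r≢0 = P-vanish isD (ℕP.n≢0⇒n>0 r≢0) (ℕP.≤-trans (ℕP.<⇒≤ r<j) (ℕP.m≤n*m (suc j) 2))

  P-agree : ∀ b {D D′} → IsMatroid D → IsMatroid D′ → Agree D D′ → rank D ≤ b → ∀ j → P D j ≡ P D′ j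
  P-agree b {D} {D′} isD isD′ agree r≤b j = by-rank (rank D ℕ.≟ 0) (rank D ℕ.≤? 2 ℕ.* j)
    where
    open Agree agree
    open Agreement agree
    by-rank : Dec (rank D ≡ 0) → Dec (rank D ≤ 2 ℕ.* j) → P D j ≡ P D′ j
    by-rank (yes r≡0) _ = trans (P-rank-zero isD r≡0 j) (sym (P-rank-zero isD′ (trans (sym rank-≡) r≡0) j))
    by-rank (no r≢0) (yes r≤2j) =
      trans (P-vanish isD (ℕP.n≢0⇒n>0 r≢0) r≤2j)
            (sym (P-vanish isD′ (subst (0 <_) rank-≡ (ℕP.n≢0⇒n>0 r≢0)) (subst (_≤ 2 ℕ.* j) rank-≡ r≤2j)))
    by-rank (no r≢0) (no r≰2j) = recurse b r≤b
      where
      n : ℕ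
      n = rank D ∸ j
      j≤r : j ≤ rank D
      j≤r = proj₁ (∸-half {j = j} r≰2j)
      r≤2n : rank D ≤ 2 ℕ.* n
      r≤2n = proj₂ (∸-half {j = j} r≰2j)
      recurse : ∀ b → rank D ≤ b → P D j ≡ P D′ j
      recurse zero    r≤0 = contradiction (ℕP.n≤0⇒n≡0 r≤0) r≢0
      recurse (suc b) r≤b = begin
        P D j
          ≡⟨ KL-recursion-at isD j≤r ⟩
        ∑[ F ← flats D ] (χ (loc D F) *ₚ P (con D F)) n
          ≡⟨ ∑-cong-∈ (flats D) (λ F m → term-≡ (proj₁ (∈flats⇒IsFlat {M = D} m))) ⟩
        ∑[ F ← flats D ] (χ (loc D′ F) *ₚ P (con D′ F)) n
          ≡⟨ cong₂ (λ Fl r → ∑[ F ← Fl ] (χ (loc D′ F) *ₚ P (con D′ F)) (r ∸ j)) flats-≡ rank-≡ ⟩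
        ∑[ F ← flats D′ ] (χ (loc D′ F) *ₚ P (con D′ F)) (rank D′ ∸ j)
          ≡⟨ KL-recursion-at isD′ (subst (j ≤_) rank-≡ j≤r) ⟨
        P D′ j ∎
        where
        open ≡-Reasoning
        term-≡ : ∀ {F} → F ⊆ E D → (χ (loc D F) *ₚ P (con D F)) n ≡ (χ (loc D′ F) *ₚ P (con D′ F)) n
        term-≡ {F} F⊆E with rk D F ℕ.≟ 0
        ... | yes rk≡0 =
          trans (recursion-term-rank-zero isD F⊆E rk≡0 (ℕP.n≢0⇒n>0 r≢0) r≤2n)
                (sym (recursion-term-rank-zero isD′ F⊆E′ (trans (sym (rk-≡ F F⊆E)) rk≡0)
                        (subst (0 <_) rank-≡ (ℕP.n≢0⇒n>0 r≢0)) (subst (_≤ 2 ℕ.* n) rank-≡ r≤2n)))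
          where
          F⊆E′ : F ⊆ E D′
          F⊆E′ = subst (F ⊆_) E-≡ F⊆E
        ... | no rk≢0 =
          *ₚ-cong (Agreement.χ-≡ (loc-agree F⊆E))
                  (P-agree b (Contraction.con-isMatroid D isD F⊆E)
                             (Contraction.con-isMatroid D′ isD′ (subst (F ⊆_) E-≡ F⊆E))
                             (con-agree F⊆E)
                             (ℕP.≤-pred (ℕP.<-≤-trans (Contraction.rank-con-< D isD F⊆E rk≢0) r≤b))) n

χ-interval : RankData N → Subset N → Subset N → Poly
χ-interval D F T a = ∑-interval D F T (λ T′ → when (rk D T ∸ rk D T′ ≡ᵇ a) (mobius D F T′))

module Localization (M : RankData N) (isM : IsMatroid M) {G : Subset N} (G-flat : IsFlat M G) where
  open Flats M isM

  ∑-interval-loc : ∀ {A B} (f : Subset N → ℤ) → B ⊆ G → ∑-interval (loc M G) A B f ≡ ∑-interval M A B f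
  ∑-interval-loc {A} {B} f B⊆G = trans (∑-flats-loc G-flat _) (∑-cong (flats M) below-G)
    where
    below-G : ∀ H → when? (H ⊆? G) (when? (A ⊆? H) (when? (H ⊆? B) (f H))) ≡ when? (A ⊆? H) (when? (H ⊆? B) (f H))
    below-G H with H ⊆? B
    ... | yes H⊆B = when?-yes (H ⊆? G) _ (⊆-trans H⊆B B⊆G)
    ... | no  _   = trans (cong (when? (H ⊆? G)) (when-zero _)) (trans (when-zero _) (sym (when-zero _)))

  mobius-loc : ∀ k {A B} → B ⊆ G → mobiusFuel (loc M G) k A B ≡ mobiusFuel M k A B
  mobius-loc k {A} {B} B⊆G = by-cases k B⊆G (A ≟ₛ B)
    where
    by-cases : ∀ k {B} → B ⊆ G → Dec (A ≡ B) → mobiusFuel (loc M G) k A B ≡ mobiusFuel M k A B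
    by-cases k       _   (yes refl) = trans (mobius-refl (loc M G) k A) (sym (mobius-refl M k A))
    by-cases zero    _   (no A≢B)   = trans (mobius-zero (loc M G) A≢B) (sym (mobius-zero M A≢B))
    by-cases (suc k) {B} B⊆G (no A≢B) =
      trans (mobius-suc (loc M G) k A≢B)
        (trans (cong -_ (trans (∑-interval-loc {A} {B} _ B⊆G) (∑-interval-cong M A B λ H _ _ H⊆B →
                  cong (when? (¬? (H ≟ₛ B))) (by-cases k (⊆-trans H⊆B B⊆G) (A ≟ₛ H)))))
               (sym (mobius-suc M k A≢B)))

  0̂-loc : zeroHat (loc M G) ≡ zeroHat M
  0̂-loc = ⊆-antisym (closure-loc⊆closure M (proj₁ G-flat)) grow
    where
    grow : zeroHat M ⊆ zeroHat (loc M G)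
    grow m with ∈-closure⁻ M m
    ... | _ , eq = ∈-closure⁺ (loc M G) (0̂⊆flat G-flat m) eq

  χ-loc : ∀ a → χ (loc M G) a ≡ χ-interval M (zeroHat M) G a
  χ-loc a = begin
    χ (loc M G) a
      ≡⟨ cong (λ Z → ∑[ K ← flats (loc M G) ] when (crk (loc M G) K ≡ᵇ a) (mobius (loc M G) Z K)) 0̂-loc ⟩
    ∑[ K ← flats (loc M G) ] when (rk M G ∸ rk M K ≡ᵇ a) (mobius (loc M G) (zeroHat M) K)
      ≡⟨ ∑-flats-loc G-flat _ ⟩
    ∑[ K ← flats M ] when? (K ⊆? G) (when (rk M G ∸ rk M K ≡ᵇ a) (mobius (loc M G) (zeroHat M) K))
      ≡⟨ ∑-cong-∈ (flats M) (λ K m → sym (when?-yes (zeroHat M ⊆? K) _ (0̂⊆flat (∈flats⇒IsFlat {M = M} m)))) ⟩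
    ∑-interval M (zeroHat M) G (λ K → when (rk M G ∸ rk M K ≡ᵇ a) (mobius (loc M G) (zeroHat M) K))
      ≡⟨ ∑-interval-cong M (zeroHat M) G (λ K _ _ K⊆G →
           cong (when (rk M G ∸ rk M K ≡ᵇ a)) (mobius-loc N {zeroHat M} K⊆G)) ⟩
    χ-interval M (zeroHat M) G a ∎
    where open ≡-Reasoning

[a∸c]∸[b∸c]≡a∸b : ∀ {a b c} → c ≤ b → b ≤ a → (a ∸ c) ∸ (b ∸ c) ≡ a ∸ b
[a∸c]∸[b∸c]≡a∸b {a} {b} {c} c≤b _ = trans (ℕP.∸-+-assoc a c (b ∸ c)) (cong (a ∸_) (ℕP.m+[n∸m]≡n c≤b))

-- The interval [F, T] of flats of M is the lattice of flats of (M^F)_{T ∖ F}.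
module Interval (M : RankData N) (isM : IsMatroid M) {F T : Subset N}
                (F-flat : IsFlat M F) (T-flat : IsFlat M T) (F⊆T : F ⊆ T) where
  open Closure M isM
  open Flats M isM
  open Contraction M isM

  private
    F⊆E : F ⊆ E M
    F⊆E = proj₁ F-flat
    L : RankData N
    L = loc (con M F) (T ─ F)

  T─F-flat : IsFlat (con M F) (T ─ F)
  T─F-flat = flat-con⁺ F⊆E ([p─q]∩q≡⊥ T F) (subst (IsFlat M) (sym (q⊆p⇒[p─q]∪q≡p F⊆T)) T-flat)

  ∑-flats-interval : (u : Subset N → ℤ) →
    ∑ (flats L) u ≡ ∑-interval M F T (λ T′ → u (T′ ─ F))
  ∑-flats-interval u =
    trans (Flats.∑-flats-loc (con M F) (con-isMatroid F⊆E) T─F-flat u)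
          (trans (∑-flats-con F⊆E _) (∑-cong (flats M) λ T′ → when?-cong (F ⊆? T′) λ F⊆T′ →
            cong (λ b → when b (u (T′ ─ F)))
                 (does-⇔ ((T′ ─ F) ⊆? (T ─ F)) (T′ ⊆? T)
                         (λ T′─F⊆T─F → subst (T′ ⊆_) (q⊆p⇒[p─q]∪q≡p F⊆T) (p─q⊆r⇒p⊆r∪q T′─F⊆T─F))
                         (─-monoˡ F))))

  ∑-interval-con : ∀ {A B} (f : Subset N → ℤ) → A ∩ F ≡ ⊥ → B ∪ F ⊆ T →
    ∑-interval L A B f ≡ ∑-interval M (A ∪ F) (B ∪ F) (λ T′ → f (T′ ─ F))
  ∑-interval-con {A} {B} f A∩F≡⊥ B∪F⊆T = trans (∑-flats-interval _) (∑-cong (flats M) pointwise)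
    where
    pointwise : ∀ T′ → when? (F ⊆? T′) (when? (T′ ⊆? T) (when? (A ⊆? (T′ ─ F)) (when? ((T′ ─ F) ⊆? B) (f (T′ ─ F)))))
                     ≡ when? ((A ∪ F) ⊆? T′) (when? (T′ ⊆? (B ∪ F)) (f (T′ ─ F)))
    pointwise T′ with F ⊆? T′
    ... | no F⊈T′ = sym (when?-no ((A ∪ F) ⊆? T′) _ (λ A∪F⊆T′ → F⊈T′ (⊆-trans (q⊆p∪q A F) A∪F⊆T′)))
    ... | yes F⊆T′ with T′ ⊆? (B ∪ F) | (T′ ─ F) ⊆? B
    ...   | yes T′⊆B∪F | yes _ =
            trans (when?-yes (T′ ⊆? T) _ (⊆-trans T′⊆B∪F B∪F⊆T))
                  (cong (λ b → when b (f (T′ ─ F)))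
                        (does-⇔ (A ⊆? (T′ ─ F)) ((A ∪ F) ⊆? T′) (p⊆r─q⇒p∪q⊆r F⊆T′) (p∪q⊆r⇒p⊆r─q A∩F≡⊥)))
    ...   | no _  | no _ = trans (cong (when? (T′ ⊆? T)) (when-zero _)) (trans (when-zero _) (sym (when-zero _)))
    ...   | yes T′⊆B∪F | no T′─F⊈B = ⊥-elim (T′─F⊈B (p⊆r∪q⇒p─q⊆r T′⊆B∪F))
    ...   | no T′⊈B∪F  | yes T′─F⊆B = ⊥-elim (T′⊈B∪F (p─q⊆r⇒p⊆r∪q T′─F⊆B))

  mobius-con : ∀ k {A B} → A ∩ F ≡ ⊥ → B ∩ F ≡ ⊥ → B ∪ F ⊆ T →
    mobiusFuel L k A B ≡ mobiusFuel M k (A ∪ F) (B ∪ F)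
  mobius-con k {A} {B} A∩F≡⊥ = by-cases k (A ≟ₛ B)
    where
    by-cases : ∀ k {B} → Dec (A ≡ B) → B ∩ F ≡ ⊥ → B ∪ F ⊆ T → mobiusFuel L k A B ≡ mobiusFuel M k (A ∪ F) (B ∪ F)
    by-cases k (yes refl) _ _ = trans (mobius-refl L k A) (sym (mobius-refl M k (A ∪ F)))
    by-cases k {B} (no A≢B) B∩F≡⊥ B∪F⊆T = by-fuel k
      where
      A∪F≢B∪F : ¬ A ∪ F ≡ B ∪ F
      A∪F≢B∪F e = A≢B (trans (sym (p∩q≡⊥⇒[p∪q]─q≡p A∩F≡⊥)) (trans (cong (_─ F) e) (p∩q≡⊥⇒[p∪q]─q≡p B∩F≡⊥)))
      by-fuel : ∀ k → mobiusFuel L k A B ≡ mobiusFuel M k (A ∪ F) (B ∪ F)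
      by-fuel zero    = trans (mobius-zero L A≢B) (sym (mobius-zero M A∪F≢B∪F))
      by-fuel (suc k) =
        trans (mobius-suc L k A≢B)
          (trans (cong -_ (trans (∑-interval-con _ A∩F≡⊥ B∪F⊆T) (∑-interval-cong M (A ∪ F) (B ∪ F) step)))
                 (sym (mobius-suc M k A∪F≢B∪F)))
        where
        step : ∀ T′ → IsFlat M T′ → A ∪ F ⊆ T′ → T′ ⊆ B ∪ F →
          when? (¬? ((T′ ─ F) ≟ₛ B)) (mobiusFuel L k A (T′ ─ F)) ≡ when? (¬? (T′ ≟ₛ (B ∪ F))) (mobiusFuel M k (A ∪ F) T′)
        step T′ _ A∪F⊆T′ T′⊆B∪F = cong₂ (λ b z → when (not b) z)
          (does-⇔ ((T′ ─ F) ≟ₛ B) (T′ ≟ₛ (B ∪ F))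
                  (λ e → trans (sym (q⊆p⇒[p─q]∪q≡p F⊆T′)) (cong (_∪ F) e))
                  (λ e → trans (cong (_─ F) e) (p∩q≡⊥⇒[p∪q]─q≡p B∩F≡⊥)))
          (trans (by-cases k (A ≟ₛ (T′ ─ F)) ([p─q]∩q≡⊥ T′ F) (subst (_⊆ T) (sym T′─F∪F≡T′) (⊆-trans T′⊆B∪F B∪F⊆T)))
                 (cong (mobiusFuel M k (A ∪ F)) T′─F∪F≡T′))
          where
          F⊆T′ : F ⊆ T′
          F⊆T′ = ⊆-trans (q⊆p∪q A F) A∪F⊆T′
          T′─F∪F≡T′ : (T′ ─ F) ∪ F ≡ T′
          T′─F∪F≡T′ = q⊆p⇒[p─q]∪q≡p F⊆T′

  0̂-interval : zeroHat L ≡ ⊥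
  0̂-interval = ⊆-antisym below-⊥ (⊆-min _)
    where
    below-⊥ : zeroHat L ⊆ ⊥
    below-⊥ m with subst (_ ∈ₛ_) (closure-con F⊆E (⊆-min _))
                         (closure-loc⊆closure (con M F) (─-monoˡ F (proj₁ T-flat)) m)
    ... | x∈cl[F]─F = contradiction (subst (_ ∈ₛ_) (trans (cong (closure M) (∪-identityˡ F)) (proj₂ F-flat))
                                            (p─q⊆p _ F x∈cl[F]─F))
                                     (x∈p─q⇒x∉q x∈cl[F]─F)

  χ-con : ∀ a → χ L a ≡ χ-interval M F T a
  χ-con a = begin
    χ L a
      ≡⟨ cong (λ Z → ∑[ K ← flats L ] when (crk L K ≡ᵇ a) (mobius L Z K)) 0̂-interval ⟩
    ∑[ K ← flats L ] when (crk L K ≡ᵇ a) (mobius L ⊥ K)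
      ≡⟨ ∑-flats-interval _ ⟩
    ∑-interval M F T (λ T′ → when (crk L (T′ ─ F) ≡ᵇ a) (mobius L ⊥ (T′ ─ F)))
      ≡⟨ ∑-interval-cong M F T (λ T′ T′-flat F⊆T′ T′⊆T →
           cong₂ (λ r z → when (r ≡ᵇ a) z) (crk-eq T′-flat F⊆T′ T′⊆T) (mobius-eq F⊆T′ T′⊆T)) ⟩
    χ-interval M F T a ∎
    where
    open ≡-Reasoning
    crk-eq : ∀ {T′} → IsFlat M T′ → F ⊆ T′ → T′ ⊆ T → crk L (T′ ─ F) ≡ rk M T ∸ rk M T′
    crk-eq {T′} (T′⊆E , _) F⊆T′ T′⊆T =
      trans (cong₂ (λ X Y → (rk M X ∸ rk M F) ∸ (rk M Y ∸ rk M F)) (q⊆p⇒[p─q]∪q≡p F⊆T) (q⊆p⇒[p─q]∪q≡p F⊆T′))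
            ([a∸c]∸[b∸c]≡a∸b (rk-mono F T′ F⊆T′ T′⊆E) (rk-mono T′ T T′⊆T (proj₁ T-flat)))
    mobius-eq : ∀ {T′} → F ⊆ T′ → T′ ⊆ T → mobius L ⊥ (T′ ─ F) ≡ mobius M F T′
    mobius-eq {T′} F⊆T′ T′⊆T =
      trans (mobius-con N (∩-zeroˡ F) ([p─q]∩q≡⊥ T′ F) (subst (_⊆ T) (sym (q⊆p⇒[p─q]∪q≡p F⊆T′)) T′⊆T))
            (cong₂ (mobiusFuel M N) (∪-identityˡ F) (q⊆p⇒[p─q]∪q≡p F⊆T′))

  con-con-agree : Agree (con (con M F) (T ─ F)) (con M T)
  con-con-agree = record { E-≡ = E-eq ; rk-≡ = rk-eq }
    where
    E-eq : (E M ─ F) ─ (T ─ F) ≡ E M ─ T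
    E-eq = trans (p─q─r≡p─q∪r (E M) F (T ─ F)) (cong (E M ─_) (trans (∪-comm F (T ─ F)) (q⊆p⇒[p─q]∪q≡p F⊆T)))
    rk-eq : ∀ S → S ⊆ (E M ─ F) ─ (T ─ F) →
      (rk M ((S ∪ (T ─ F)) ∪ F) ∸ rk M F) ∸ (rk M ((T ─ F) ∪ F) ∸ rk M F) ≡ rk M (S ∪ T) ∸ rk M T
    rk-eq S S⊆ =
      trans (cong₂ (λ X Y → (rk M X ∸ rk M F) ∸ (rk M Y ∸ rk M F)) S∪T─F∪F≡S∪T (q⊆p⇒[p─q]∪q≡p F⊆T))
            ([a∸c]∸[b∸c]≡a∸b (rk-mono F T F⊆T (proj₁ T-flat))
                             (rk-mono T (S ∪ T) (q⊆p∪q S T) (∪-least S⊆E (proj₁ T-flat))))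
      where
      S⊆E : S ⊆ E M
      S⊆E = ⊆-trans S⊆ (⊆-trans (p─q⊆p _ _) (p─q⊆p _ _))
      S∪T─F∪F≡S∪T : (S ∪ (T ─ F)) ∪ F ≡ S ∪ T
      S∪T─F∪F≡S∪T = trans (∪-assoc S (T ─ F) F) (cong (S ∪_) (q⊆p⇒[p─q]∪q≡p F⊆T))

module Summation (P : RankData N → Poly) (isKL : IsKL P) (M : RankData N) (isM : IsMatroid M) where
  open Closure M isM
  open Flats M isM
  open Contraction M isM
  open KazhdanLusztig P isKL

  KL-recursion-con : ∀ {F} → IsFlat M F → ∀ n →
    coef (P (con M F)) (+ crk M F - + n) ≡ ∑[ T ← flats M ] when? (F ⊆? T) ((χ-interval M F T *ₚ P (con M T)) n)
  KL-recursion-con {F} F-flat n = begin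
    coef (P (con M F)) (+ crk M F - + n)
      ≡⟨ cong (λ r → coef (P (con M F)) (+ r - + n)) (rank-con F⊆E) ⟨
    coef (P (con M F)) (+ rank (con M F) - + n)
      ≡⟨ KL-recursion (con-isMatroid F⊆E) n ⟩
    ∑[ K ← flats (con M F) ] (χ (loc (con M F) K) *ₚ P (con (con M F) K)) n
      ≡⟨ ∑-flats-con F⊆E _ ⟩
    ∑[ T ← flats M ] when? (F ⊆? T) ((χ (loc (con M F) (T ─ F)) *ₚ P (con (con M F) (T ─ F))) n)
      ≡⟨ ∑-cong-∈ (flats M) (λ T m → when?-cong (F ⊆? T) (interval-term (∈flats⇒IsFlat {M = M} m))) ⟩
    ∑[ T ← flats M ] when? (F ⊆? T) ((χ-interval M F T *ₚ P (con M T)) n) ∎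
    where
    open ≡-Reasoning
    F⊆E : F ⊆ E M
    F⊆E = proj₁ F-flat
    interval-term : ∀ {T} → IsFlat M T → F ⊆ T →
      (χ (loc (con M F) (T ─ F)) *ₚ P (con (con M F) (T ─ F))) n ≡ (χ-interval M F T *ₚ P (con M T)) n
    interval-term {T} T-flat F⊆T =
      *ₚ-cong χ-con (P-agree _ (Contraction.con-isMatroid (con M F) (con-isMatroid F⊆E) (proj₁ T─F-flat))
                               (con-isMatroid (proj₁ T-flat)) con-con-agree ℕP.≤-refl) n
      where open Interval M isM F-flat T-flat F⊆T

  ∑-χ-interval : ∀ {T} → IsFlat M T → ∀ a →
    ∑[ F ← flats M ] when? (F ⊆? T) (χ-interval M F T a) ≡ when (rk M T ≡ᵇ a) (+ 1)
  ∑-χ-interval {T} T-flat a = begin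
    ∑[ F ← flats M ] when? (F ⊆? T) (χ-interval M F T a)
      ≡⟨ ∑-cong-∈ (flats M) (λ F m → sym (when?-yes (0̂ ⊆? F) _ (0̂⊆flat (∈flats⇒IsFlat {M = M} m)))) ⟩
    ∑-interval M 0̂ T (λ F → ∑-interval M F T (λ H → when (c H) (mobius M F H)))
      ≡⟨ ∑-interval-swap M {0̂} {T} (λ F H → when (c H) (mobius M F H)) ⟩
    ∑-interval M 0̂ T (λ H → ∑-interval M 0̂ H (λ F → when (c H) (mobius M F H)))
      ≡⟨ ∑-interval-cong M 0̂ T (λ H H-flat 0̂⊆H _ →
           trans (∑-interval-when M {0̂} {H} (c H) (λ F → mobius M F H))
                 (cong (when (c H)) (∑-interval-mobiusʳ M 0̂-flat H-flat 0̂⊆H))) ⟩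
    ∑-interval M 0̂ T (λ H → when (c H) (δ 0̂ H))
      ≡⟨ ∑-interval-single M {0̂} {T} _ 0̂ 0̂-flat ⊆-refl (0̂⊆flat T-flat)
           (λ H _ _ _ H≢0̂ → trans (cong (when (c H)) (when?-no (0̂ ≟ₛ H) _ (H≢0̂ ∘′ sym))) (when-zero (c H))) ⟩
    when (c 0̂) (δ 0̂ 0̂)
      ≡⟨ cong₂ (λ r z → when (rk M T ∸ r ≡ᵇ a) z) rk-0̂ (when?-yes (0̂ ≟ₛ 0̂) _ refl) ⟩
    when (rk M T ≡ᵇ a) (+ 1) ∎
    where
    open ≡-Reasoning
    0̂ : Subset N
    0̂ = zeroHat M
    c : Subset N → Bool
    c H = rk M T ∸ rk M H ≡ᵇ a

  ∑-coef-crk≡∑-coef-rk : ∀ i →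
    ∑[ F ← flats M ] coef (P (con M F)) (+ crk M F - + i) ≡ ∑[ T ← flats M ] coef (P (con M T)) (+ i - + rkF M T)
  ∑-coef-crk≡∑-coef-rk i = begin
    ∑[ F ← flats M ] coef (P (con M F)) (+ crk M F - + i)
      ≡⟨ ∑-cong-∈ (flats M) (λ F m → KL-recursion-con (∈flats⇒IsFlat {M = M} m) i) ⟩
    ∑[ F ← flats M ] ∑[ T ← flats M ] when? (F ⊆? T) ((χ-interval M F T *ₚ P (con M T)) i)
      ≡⟨ ∑-swap (flats M) (flats M) _ ⟩
    ∑[ T ← flats M ] ∑[ F ← flats M ] when? (F ⊆? T) ((χ-interval M F T *ₚ P (con M T)) i)
      ≡⟨ ∑-cong-∈ (flats M) (λ T m → by-rank (∈flats⇒IsFlat {M = M} m)) ⟩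
    ∑[ T ← flats M ] coef (P (con M T)) (+ i - + rkF M T) ∎
    where
    open ≡-Reasoning
    by-rank : ∀ {T} → IsFlat M T →
      ∑[ F ← flats M ] when? (F ⊆? T) ((χ-interval M F T *ₚ P (con M T)) i) ≡ coef (P (con M T)) (+ i - + rk M T)
    by-rank {T} T-flat = begin
      ∑[ F ← flats M ] when? (F ⊆? T) (∑[ a ← upTo (suc i) ] χ-interval M F T a * P (con M T) (i ∸ a))
        ≡⟨ ∑-cong (flats M) (λ F → sym (∑-when (does (F ⊆? T)) (upTo (suc i)) _)) ⟩
      ∑[ F ← flats M ] ∑[ a ← upTo (suc i) ] when? (F ⊆? T) (χ-interval M F T a * P (con M T) (i ∸ a))
        ≡⟨ ∑-swap (flats M) (upTo (suc i)) _ ⟩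
      ∑[ a ← upTo (suc i) ] ∑[ F ← flats M ] when? (F ⊆? T) (χ-interval M F T a * P (con M T) (i ∸ a))
        ≡⟨ ∑-cong (upTo (suc i)) (λ a → trans (∑-cong (flats M) (λ F → sym (when-*ʳ (does (F ⊆? T)) _ _)))
                                              (∑-*ʳ (flats M) _ (P (con M T) (i ∸ a)))) ⟩
      ∑[ a ← upTo (suc i) ] (∑[ F ← flats M ] when? (F ⊆? T) (χ-interval M F T a)) * P (con M T) (i ∸ a)
        ≡⟨ ∑-cong (upTo (suc i)) (λ a → trans (cong (_* P (con M T) (i ∸ a)) (∑-χ-interval T-flat a))
                                              (trans (when-*ʳ (rk M T ≡ᵇ a) (+ 1) _)
                                                     (cong (when (rk M T ≡ᵇ a)) (ℤP.*-identityˡ _)))) ⟩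
      ∑[ a ← upTo (suc i) ] when (rk M T ≡ᵇ a) (P (con M T) (i ∸ a))
        ≡⟨ ∑-upTo-δ (suc i) (rk M T) (λ a → P (con M T) (i ∸ a)) ⟩
      when? (rk M T ℕ.<? suc i) (P (con M T) (i ∸ rk M T))
        ≡⟨ cong (λ b → when b (P (con M T) (i ∸ rk M T))) (does-⇔ (rk M T ℕ.<? suc i) (rk M T ℕ.≤? i) ℕP.≤-pred s≤s) ⟩
      when? (rk M T ℕ.≤? i) (P (con M T) (i ∸ rk M T))
        ≡⟨ coef-∸-when (P (con M T)) i (rk M T) ⟨
      coef (P (con M T)) (+ i - + rk M T) ∎

  P≡P-con-0̂ : ∀ i → P M i ≡ P (con M (zeroHat M)) i
  P≡P-con-0̂ i with i ℕ.≤? rank M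
  ... | no i≰r = trans (P-above-rank isM (ℕP.≰⇒> i≰r))
                       (sym (P-above-rank (con-isMatroid (proj₁ 0̂-flat)) (subst (_< i) (sym rank-con-0̂) (ℕP.≰⇒> i≰r))))
    where
    rank-con-0̂ : rank (con M (zeroHat M)) ≡ rank M
    rank-con-0̂ = trans (rank-con (proj₁ 0̂-flat)) (cong (rank M ∸_) rk-0̂)
  ... | yes i≤r = begin
    P M i
      ≡⟨ KL-recursion-at isM i≤r ⟩
    ∑[ G ← flats M ] (χ (loc M G) *ₚ P (con M G)) n
      ≡⟨ ∑-cong-∈ (flats M) (λ G m → let G-flat = ∈flats⇒IsFlat {M = M} m in
           trans (*ₚ-cong {q = P (con M G)} (Localization.χ-loc M isM G-flat) (λ _ → refl) n)
                 (sym (when?-yes (zeroHat M ⊆? G) _ (0̂⊆flat G-flat)))) ⟩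
    ∑[ G ← flats M ] when? (zeroHat M ⊆? G) ((χ-interval M (zeroHat M) G *ₚ P (con M G)) n)
      ≡⟨ KL-recursion-con 0̂-flat n ⟨
    coef (P (con M (zeroHat M))) (+ crk M (zeroHat M) - + n)
      ≡⟨ cong (λ r → coef (P (con M (zeroHat M))) (+ (rank M ∸ r) - + n)) rk-0̂ ⟩
    coef (P (con M (zeroHat M))) (+ rank M - + n)
      ≡⟨ coef-∸ (P (con M (zeroHat M))) (ℕP.m∸n≤m (rank M) i) ⟩
    P (con M (zeroHat M)) (rank M ∸ n)
      ≡⟨ cong (P (con M (zeroHat M))) (ℕP.m∸[m∸n]≡n i≤r) ⟩
    P (con M (zeroHat M)) i ∎
    where
    open ≡-Reasoning
    n : ℕ
    n = rank M ∸ i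

  ∑-flats≡0̂+∑-nonzeroFlats : (g : Subset N → ℤ) → ∑ (flats M) g ≡ g (zeroHat M) + ∑ (nonzeroFlats M) g
  ∑-flats≡0̂+∑-nonzeroFlats g =
    trans (∑-cong (flats M) (λ F → when?-split (F ≟ₛ zeroHat M) (g F)))
          (trans (∑-+ (flats M) _ _)
                 (cong₂ _+_ (∑-flats-δ M g 0̂-flat) (sym (∑-filter (λ F → ¬? (F ≟ₛ zeroHat M)) (flats M) g))))

corollary2p5 : {N : ℕ} (P : RankData N → Poly) → IsKL P →
    (M : RankData N) → IsMatroid M → (i : ℕ) →
    P M i ≡
      Σℤ (map (λ F → coef (P (con M F)) (+ crk M F - + i)) (flats M))
      - Σℤ (map (λ F → coef (P (con M F)) (+ i - + rkF M F)) (nonzeroFlats M))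
corollary2p5 P isKL M isM i = begin
  P M i                                          ≡⟨ P≡P-con-0̂ i ⟩
  P (con M 0̂) i                                  ≡⟨ g-0̂ ⟨
  g 0̂                                            ≡⟨ ℤ+.//-rightDividesʳ S (g 0̂) ⟨
  g 0̂ + S - S                                    ≡⟨ cong (_- S) (∑-flats≡0̂+∑-nonzeroFlats g) ⟨
  ∑ (flats M) g - S                              ≡⟨ cong (_- S) (∑-coef-crk≡∑-coef-rk i) ⟨
  (∑[ F ← flats M ] coef (P (con M F)) (+ crk M F - + i)) - S ∎
  where
  open ≡-Reasoning
  open Flats M isM using (rk-0̂)
  open Summation P isKL M isM
  0̂ : Subset _
  0̂ = zeroHat M
  g : Subset _ → ℤ
  g F = coef (P (con M F)) (+ i - + rkF M F)
  S : ℤ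
  S = ∑ (nonzeroFlats M) g
  g-0̂ : g 0̂ ≡ P (con M 0̂) i
  g-0̂ = trans (cong (λ r → coef (P (con M 0̂)) (+ i - + r)) rk-0̂) (coef-∸ (P (con M 0̂)) z≤n)
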